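{- Let $k\geq 2$. Let $\mathcal{SCU}_k(n)$ denote the number of self-conjugate $k$-marked strongly unimodal symbols of size $n$, and $SCU_k(q):=\sum_{n\ge 0}\mathcal{SCU}_k(n)q^n$. Then \[ SCU_k(q)=\sum_{n\geq0}(-1)^k\big(\omega_k(n)-\epsilon_k(n)\big)q^n . \]
   Context: A strongly unimodal sequence of size $n$ is a finite list of positive integers $a_1<\cdots<a_r>a_{r+1}>\cdots>a_s$ summing to $n$, with peak $a_r$. Its strongly unimodal symbol consists of the peak size $P=a_r$, a top row listing the parts right of the peak ($a_{r+1}>\cdots>a_s$), and a bottom row listing the parts left of the peak in decreasing order ($a_{r-1}>\cdots>a_1$); the size is $P$ plus the sum of all parts in both rows. A $k$-marked strongly unimodal symbol ($k\ge2$) is such a symbol in which every part in both rows carries a subscript from $\{1,\dots,k\}$, subject to: (1) in each row the parts are strictly decreasing and the subscripts are nonincreasing; (2) in the top row each of $1,\dots,k-1$ appears as a subscript of some part; (3) letting $M_j$ be the largest part with subscript $j$ in the top row ($1\le j\le k-1$), $M_0:=0$, and $M_k$ the peak size, all bottom-row parts with subscript $j\le k-1$ lie in $[M_{j-1}+1,M_j]$ and those with subscript $k$ lie in $[M_{k-1}+1,M_k-1]$. It is self-conjugate if its top and bottom rows are identical (same parts with the same subscripts). $\omega_k(n)$ counts the objects of total size $n$ consisting of: a partition into at least $k$ unmarked odd parts such that every odd part less than the largest part appears at least once; together with even parts taking exactly $k-1$ distinct values, these values carrying the $k-1$ different marks $1,\dots,k-1$ (i.e. values $2M_1<2M_2<\cdots<2M_{k-1}$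 with $2M_j$ marked $j$), each value allowed to repeat, every even part less than twice the number of odd parts, and the total number of even parts odd. $\epsilon_k(n)$ counts the same objects except that the total number of even parts is even. -}

module Defs where

open import Data.Bool using (Bool; true; false; _∧_; _∨_; not; if_then_else_)
open import Data.Nat using (ℕ; zero; suc; _+_; _*_; _∸_; _⊔_; _<ᵇ_; _≡ᵇ_; _≤ᵇ_)
open import Data.List using (List; []; _∷_; length; map; upTo; concatMap; cartesianProduct)
open import Data.Bool.ListAction using (all; any)
open import Data.Nat.ListAction using (sum)
open import Data.Product using (_×_; _,_; proj₁; proj₂)
open import Data.Integer as ℤ using (ℤ; +_)

range : ℕ → List ℕ
range n = upTo (suc n)

listsUpTo : {A : Set} → ℕ → List A → List (List A)
listsUpTo zero    xs = [] ∷ []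
listsUpTo (suc L) xs = [] ∷ concatMap (λ x → map (x ∷_) (listsUpTo L xs)) xs

count : {A : Set} → (A → Bool) → List A → ℕ
count p []       = 0
count p (x ∷ xs) = if p x then suc (count p xs) else count p xs

elem : ℕ → List ℕ → Bool
elem v xs = any (λ x → x ≡ᵇ v) xs

isOdd : ℕ → Bool
isOdd zero          = false
isOdd (suc zero)    = true
isOdd (suc (suc n)) = isOdd n

maxL : List ℕ → ℕ
maxL []       = 0
maxL (x ∷ xs) = x ⊔ maxL xs

strictlyDecreasing : List ℕ → Bool
strictlyDecreasing []           = true
strictlyDecreasing (x ∷ [])     = true
strictlyDecreasing (x ∷ y ∷ r)  = (y <ᵇ x) ∧ strictlyDecreasing (y ∷ r)

nonincreasing : List ℕ → Bool
nonincreasing []           = true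
nonincreasing (x ∷ [])     = true
nonincreasing (x ∷ y ∷ r)  = (y ≤ᵇ x) ∧ nonincreasing (y ∷ r)

-- k-marked strongly unimodal symbols
-- A row is a list of (part , subscript) pairs, listed left to right.

Row : Set
Row = List (ℕ × ℕ)

parts : Row → List ℕ
parts = map proj₁

marks : Row → List ℕ
marks = map proj₂

largestWithMark : ℕ → Row → ℕ
largestWithMark j []             = 0
largestWithMark j ((a , m) ∷ r) = if m ≡ᵇ j then a ⊔ largestWithMark j r else largestWithMark j r

-- M_j for 0 ≤ j ≤ k :  M_0 = 0, M_k = peak P, otherwise the largest
-- top-row part with subscript j
Mval : ℕ → ℕ → Row → ℕ → ℕ
Mval k P top zero    = 0
Mval k P top (suc i) = if suc i ≡ᵇ k then P else largestWithMark (suc i) top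

bottomPartOK : ℕ → ℕ → Row → ℕ × ℕ → Bool
bottomPartOK k P top (a , j) =
  if j ≡ᵇ k
  then (Mval k P top (j ∸ 1) <ᵇ a) ∧ (a <ᵇ P)
  else (Mval k P top (j ∸ 1) <ᵇ a) ∧ (a ≤ᵇ Mval k P top j)

isKMarkedSymbol : ℕ → ℕ → Row → Row → Bool
isKMarkedSymbol k P top bot =
     (1 ≤ᵇ P)
  ∧ all (λ a → (1 ≤ᵇ a) ∧ (a <ᵇ P)) (parts top)
  ∧ all (λ a → (1 ≤ᵇ a) ∧ (a <ᵇ P)) (parts bot)
  ∧ all (λ m → (1 ≤ᵇ m) ∧ (m ≤ᵇ k)) (marks top)
  ∧ all (λ m → (1 ≤ᵇ m) ∧ (m ≤ᵇ k)) (marks bot)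
  ∧ strictlyDecreasing (parts top) ∧ nonincreasing (marks top)
  ∧ strictlyDecreasing (parts bot) ∧ nonincreasing (marks bot)
  ∧ all (λ j → elem j (marks top)) (map suc (upTo (k ∸ 1)))
  ∧ all (bottomPartOK k P top) bot

symbolSize : ℕ → Row → Row → ℕ
symbolSize P top bot = P + sum (parts top) + sum (parts bot)

-- A self-conjugate symbol is determined by its peak P and its common
-- row; it is valid iff the symbol (P, row, row) is a k-marked symbol.
isSelfConjOfSize : ℕ → ℕ → ℕ × Row → Bool
isSelfConjOfSize k n (P , row) =
  isKMarkedSymbol k P row row ∧ (symbolSize P row row ≡ᵇ n)

-- candidates: peak ≤ n, row of length ≤ n with parts ≤ n and marks ≤ k
-- (every self-conjugate symbol of size n is among them)
scuCandidates : ℕ → ℕ → List (ℕ × Row)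
scuCandidates k n =
  cartesianProduct (range n) (listsUpTo n (cartesianProduct (range n) (range k)))

SCU : ℕ → ℕ → ℕ
SCU k n = count (isSelfConjOfSize k n) (scuCandidates k n)

-- ω_k(n) and ε_k(n)
-- An object is a pair (odds , evens) of nonincreasing lists (multisets)
-- of odd parts and even parts.  The marks on the even parts are forced
-- (the j-th smallest distinct even value carries mark j), so they are
-- not recorded.

oddPartOK : ℕ → List ℕ → Bool
oddPartOK k os =
     all isOdd os
  ∧ nonincreasing os
  ∧ (k ≤ᵇ length os)
  ∧ all (λ v → not (isOdd v ∧ (v <ᵇ maxL os)) ∨ elem v os) (range (maxL os))

distinctCount : List ℕ → ℕ
distinctCount es = count (λ v → elem v es) (range (maxL es))

evenPartOK : ℕ → ℕ → List ℕ → Bool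
evenPartOK k numOdd es =
     all (λ e → (1 ≤ᵇ e) ∧ not (isOdd e)) es
  ∧ nonincreasing es
  ∧ (distinctCount es ≡ᵇ (k ∸ 1))
  ∧ all (λ e → e <ᵇ 2 * numOdd) es

-- parity : true = total number of even parts is odd (ω), false = even (ε)
isOmegaEps : Bool → ℕ → ℕ → List ℕ × List ℕ → Bool
isOmegaEps parity k n (os , es) =
     oddPartOK k os
  ∧ evenPartOK k (length os) es
  ∧ (isOdd (length es) ≡ᵇᵇ parity)
  ∧ (sum os + sum es ≡ᵇ n)
  where
  _≡ᵇᵇ_ : Bool → Bool → Bool
  true  ≡ᵇᵇ b = b
  false ≡ᵇᵇ b = not b

oeCandidates : ℕ → List (List ℕ × List ℕ)
oeCandidates n = cartesianProduct (listsUpTo n (range n)) (listsUpTo n (range n))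

ω : ℕ → ℕ → ℕ
ω k n = count (isOmegaEps true k n) (oeCandidates n)

ε : ℕ → ℕ → ℕ
ε k n = count (isOmegaEps false k n) (oeCandidates n)

module Submission where

-- Both sides are counted by words whose letter at position v = 1, 2, … adds 1 + 2v · (weight) to
-- the size.  A self-conjugate symbol with peak P is a word of length P − 1 over three cells that
-- record, for each value below the peak, whether it is a part and whether it is the largest part
-- M_j of its mark j < k; there are k − 1 cells of the last kind.  An ω/ε object is a word of
-- letters (m , b): the odd parts, read from the largest, descend to 1 and the v-th step down is
-- 2 · b, while the even part 2v occurs m times.  Weighted by (−1)^m, the sum over the letters (m , b) telescopes
-- coefficientwise to the three cells, the letters with m > 0 (which create a new distinct even
-- value) surviving with sign −1; the leftover top term lies beyond every size in range.  Hence
-- ε − ω, the signed count of ω/ε words, is (−1)^(k−1) times the number of symbols.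

open import Algebra.Bundles using (CommutativeMonoid)
open import Data.Bool using (Bool; true; false; T; not; _∧_; _∨_; if_then_else_)
open import Data.Bool.ListAction using (all)
open import Data.Bool.Properties using (T-∧; T-∨; T-≡; T-not-≡; ∧-commutativeMonoid; ∧-zeroʳ; ∨-assoc; ∨-identityʳ; ∨-idem)
open import Algebra.Properties.CommutativeSemigroup (CommutativeMonoid.commutativeSemigroup ∧-commutativeMonoid)
  using () renaming (interchange to ∧-interchange)
open import Data.Empty using (⊥; ⊥-elim)
open import Data.Integer using (ℤ; +_; -_; _-_; 0ℤ; 1ℤ; -1ℤ; _^_) renaming (_+_ to _+ℤ_; _*_ to _*ℤ_)
import Data.Integer.Properties as ℤ
open import Data.Integer.Tactic.RingSolver using (solve-∀)
open import Data.List
  using (List; []; _∷_; _++_; length; map; replicate; reverse; upTo; filterᵇ; concatMap; cartesianProduct; cartesianProductWith)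
open import Data.List.Properties
  using (length-map; length-++; length-replicate; ∷-injective; upTo-∷ʳ; ++-assoc; ++-identityʳ; unfold-reverse; length-reverse;
         reverse-involutive)
open import Data.List.Membership.Propositional using (_∈_)
open import Data.List.Membership.Propositional.Properties
  using (∈-map⁺; ∈-map⁻; ∈-filter⁺; ∈-filter⁻; ∈-upTo⁺; ∈-upTo⁻; ∈-cartesianProduct⁺; ∈-cartesianProductWith⁺; ∈-cartesianProductWith⁻)
open import Data.List.Membership.Propositional.Properties.WithK using (unique∧set⇒bag)
open import Data.List.Relation.Binary.BagAndSetEquality using (∼bag⇒↭; _∼[_]_; set)
open import Data.List.Relation.Binary.Permutation.Propositional.Properties using (↭-length)
open import Data.List.Relation.Unary.All as All using (All; []; _∷_)
import Data.List.Relation.Unary.All.Properties as All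
open import Data.List.Relation.Unary.AllPairs using (AllPairs; []; _∷_)
import Data.List.Relation.Unary.AllPairs.Properties as AllPairs
open import Data.List.Relation.Unary.Any using (here; there)
open import Data.List.Relation.Unary.Linked using (Linked; []; [-]; _∷_)
import Data.List.Relation.Unary.Linked.Properties as Linked
open import Data.List.Relation.Unary.Linked.Properties using (Linked⇒All; Linked⇒AllPairs; AllPairs⇒Linked)
open import Data.List.Relation.Unary.Unique.Propositional using (Unique)
import Data.List.Relation.Unary.Unique.Propositional.Properties as Unique
open import Data.Nat using (ℕ; zero; suc; _+_; _∸_; _≤_; _<_; _≥_; _>_; s≤s; z≤n; _≡ᵇ_; _≤ᵇ_; _<ᵇ_)
open import Data.Nat.ListAction using (sum)
open import Data.Nat.ListAction.Properties using (sum-++)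
import Data.Nat.Tactic.RingSolver as ℕ-Solver
import Data.Nat.Properties as ℕ
open import Data.Product using (Σ; _×_; _,_; proj₁; proj₂)
open import Data.Sum using (_⊎_; inj₁; inj₂)
open import Data.Unit using (⊤)
open import Function using (_∘_; _on_; case_of_)
open import Function.Bundles using (_⇔_; mk⇔; Equivalence)
open import Relation.Binary.Definitions using (tri<; tri≈; tri>)
open import Relation.Binary.PropositionalEquality
open import Relation.Nullary using (¬_; yes; no)
open import Defs

module _ where

  -- ℕ multiplication is opened only inside this block, so that `_*_` in the final statement is
  -- integer multiplication.
  open import Data.Nat using (_*_)

  ¬T⇒≡false : {b : Bool} → ¬ T b → b ≡ false
  ¬T⇒≡false {true} ¬t = ⊥-elim (¬t _)
  ¬T⇒≡false {false} _ = refl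

  ≡ᵇ-refl : (c : ℕ) → (c ≡ᵇ c) ≡ true
  ≡ᵇ-refl c = Equivalence.to T-≡ (ℕ.≡⇒≡ᵇ c c refl)

  ≢⇒≡ᵇ≡false : {m n : ℕ} → m ≢ n → (m ≡ᵇ n) ≡ false
  ≢⇒≡ᵇ≡false {m} {n} m≢n = ¬T⇒≡false (m≢n ∘ ℕ.≡ᵇ⇒≡ m n)

  <⇒<ᵇ≡true : {m n : ℕ} → m < n → (m <ᵇ n) ≡ true
  <⇒<ᵇ≡true m<n = Equivalence.to T-≡ (ℕ.<⇒<ᵇ m<n)

  ≤⇒<ᵇ≡false : {m n : ℕ} → n ≤ m → (m <ᵇ n) ≡ false
  ≤⇒<ᵇ≡false {m} {n} n≤m = ¬T⇒≡false (ℕ.≤⇒≯ n≤m ∘ ℕ.<ᵇ⇒< m n)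

  <⇒≤ᵇ≡false : {m n : ℕ} → n < m → (m ≤ᵇ n) ≡ false
  <⇒≤ᵇ≡false {m} {n} n<m = ¬T⇒≡false (ℕ.<⇒≱ n<m ∘ ℕ.≤ᵇ⇒≤ m n)

  ≡ᵇ-+ : (a b j : ℕ) → (a + b ≡ᵇ j) ≡ (a ≤ᵇ j) ∧ (b ≡ᵇ j ∸ a)
  ≡ᵇ-+ zero b j = refl
  ≡ᵇ-+ (suc a) b zero = refl
  ≡ᵇ-+ (suc a) b (suc j) = trans (≡ᵇ-+ a b j) (cong (_∧ (b ≡ᵇ j ∸ a)) (<ᵇ-suc a j))
    where
    <ᵇ-suc : (a j : ℕ) → (a ≤ᵇ j) ≡ (a <ᵇ suc j)
    <ᵇ-suc zero j = refl
    <ᵇ-suc (suc a) j = refl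

  T-∧⁺ : {a b : Bool} → T a → T b → T (a ∧ b)
  T-∧⁺ ta tb = Equivalence.from T-∧ (ta , tb)

  T-∧⁻ : {a b : Bool} → T (a ∧ b) → T a × T b
  T-∧⁻ = Equivalence.to T-∧

  T-implies : {a b : Bool} → T (not a ∨ b) ⇔ (T a → T b)
  T-implies {true} = mk⇔ (λ tb _ → tb) (λ f → f _)
  T-implies {false} = mk⇔ (λ _ ()) (λ _ → _)

  T-elem : {v : ℕ} {xs : List ℕ} → T (elem v xs) ⇔ v ∈ xs
  T-elem = mk⇔ to from
    where
    to : ∀ {v xs} → T (elem v xs) → v ∈ xs
    to {v} {x ∷ xs} t with Equivalence.to (T-∨ {x ≡ᵇ v}) t
    ... | inj₁ x≡v = here (sym (ℕ.≡ᵇ⇒≡ x v x≡v))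
    ... | inj₂ t′ = there (to t′)
    from : ∀ {v xs} → v ∈ xs → T (elem v xs)
    from {v} {x ∷ xs} (here refl) = Equivalence.from (T-∨ {x ≡ᵇ v}) (inj₁ (ℕ.≡⇒≡ᵇ v v refl))
    from {v} {x ∷ xs} (there v∈) = Equivalence.from (T-∨ {x ≡ᵇ v}) (inj₂ (from v∈))

  elem-++ : (v : ℕ) (xs ys : List ℕ) → elem v (xs ++ ys) ≡ elem v xs ∨ elem v ys
  elem-++ v [] ys = refl
  elem-++ v (x ∷ xs) ys rewrite elem-++ v xs ys = sym (∨-assoc (x ≡ᵇ v) (elem v xs) (elem v ys))

  T-nonincreasing : {xs : List ℕ} → T (nonincreasing xs) ⇔ Linked _≥_ xs
  T-nonincreasing = mk⇔ to from
    where
    to : ∀ {xs} → T (nonincreasing xs) → Linked _≥_ xs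
    to {[]} _ = []
    to {x ∷ []} _ = [-]
    to {x ∷ y ∷ xs} t = let y≤x , t′ = T-∧⁻ t in ℕ.≤ᵇ⇒≤ y x y≤x ∷ to t′
    from : ∀ {xs} → Linked _≥_ xs → T (nonincreasing xs)
    from [] = _
    from [-] = _
    from (y≤x ∷ l) = T-∧⁺ (ℕ.≤⇒≤ᵇ y≤x) (from l)

  T-strictlyDecreasing : {xs : List ℕ} → T (strictlyDecreasing xs) ⇔ Linked _>_ xs
  T-strictlyDecreasing = mk⇔ to from
    where
    to : ∀ {xs} → T (strictlyDecreasing xs) → Linked _>_ xs
    to {[]} _ = []
    to {x ∷ []} _ = [-]
    to {x ∷ y ∷ xs} t = let y<x , t′ = T-∧⁻ t in ℕ.<ᵇ⇒< y x y<x ∷ to t′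
    from : ∀ {xs} → Linked _>_ xs → T (strictlyDecreasing xs)
    from [] = _
    from [-] = _
    from (y<x ∷ l) = T-∧⁺ (ℕ.<⇒<ᵇ y<x) (from l)

  -- Counting by bijection

  count≡length∘filterᵇ : {A : Set} (p : A → Bool) (xs : List A) → count p xs ≡ length (filterᵇ p xs)
  count≡length∘filterᵇ p [] = refl
  count≡length∘filterᵇ p (x ∷ xs) with p x
  ... | true = cong suc (count≡length∘filterᵇ p xs)
  ... | false = count≡length∘filterᵇ p xs

  module _ {A : Set} where

    count-cong : {p q : A → Bool} (xs : List A) → (∀ x → p x ≡ q x) → count p xs ≡ count q xs
    count-cong [] e = refl
    count-cong {p} {q} (x ∷ xs) e rewrite e x with q x
    ... | true = cong suc (count-cong xs e)
    ... | false = count-cong xs e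

    count-none : (p : A → Bool) {xs : List A} → All (¬_ ∘ T ∘ p) xs → count p xs ≡ 0
    count-none p [] = refl
    count-none p (¬px ∷ none) rewrite ¬T⇒≡false ¬px = count-none p none

    count-∨ : (p q : A → Bool) (xs : List A) → (∀ x → T (p x) → ¬ T (q x)) →
              count (λ x → p x ∨ q x) xs ≡ count p xs + count q xs
    count-∨ p q [] disjoint = refl
    count-∨ p q (x ∷ xs) disjoint with p x in px | q x in qx
    ... | true | true = ⊥-elim (disjoint x (subst T (sym px) _) (subst T (sym qx) _))
    ... | true | false = cong suc (count-∨ p q xs disjoint)
    ... | false | true = trans (cong suc (count-∨ p q xs disjoint)) (sym (ℕ.+-suc _ _))
    ... | false | false = count-∨ p q xs disjoint

  count-++ : {A : Set} (p : A → Bool) (xs ys : List A) → count p (xs ++ ys) ≡ count p xs + count p ys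
  count-++ p [] ys = refl
  count-++ p (x ∷ xs) ys with p x
  ... | true = cong suc (count-++ p xs ys)
  ... | false = count-++ p xs ys

  count≤length : {A : Set} (p : A → Bool) (xs : List A) → count p xs ≤ length xs
  count≤length p [] = z≤n
  count≤length p (x ∷ xs) with p x
  ... | true = s≤s (count≤length p xs)
  ... | false = ℕ.m≤n⇒m≤1+n (count≤length p xs)

  module _ {A B : Set} (f : A → B) (g : B → A) where

    Unique-map⁺-retract : {zs : List A} → (∀ {z} → z ∈ zs → g (f z) ≡ z) → Unique zs → Unique (map f zs)
    Unique-map⁺-retract inv [] = []
    Unique-map⁺-retract inv (z∉ ∷ u) =
      All.map⁺ (All.tabulate λ w∈ fz≡fw →
        All.lookup z∉ w∈ (trans (sym (inv (here refl))) (trans (cong g fz≡fw) (inv (there w∈)))))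
      ∷ Unique-map⁺-retract (λ z∈ → inv (there z∈)) u

    count-bijection : {p : A → Bool} {q : B → Bool} {xs : List A} {ys : List B} →
      Unique xs → Unique ys →
      (∀ {x} → x ∈ xs → T (p x) → f x ∈ ys × T (q (f x)) × g (f x) ≡ x) →
      (∀ {y} → y ∈ ys → T (q y) → g y ∈ xs × T (p (g y)) × f (g y) ≡ y) →
      count p xs ≡ count q ys
    count-bijection {p} {q} {xs} {ys} uxs uys to from = begin
      count p xs                   ≡⟨ count≡length∘filterᵇ p xs ⟩
      length (filterᵇ p xs)         ≡⟨ length-map f (filterᵇ p xs) ⟨
      length (map f (filterᵇ p xs)) ≡⟨ ↭-length (∼bag⇒↭ (unique∧set⇒bag uniq (Unique.filter⁺ _ uys) sameMembers)) ⟩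
      length (filterᵇ q ys)         ≡⟨ count≡length∘filterᵇ q ys ⟨
      count q ys                   ∎
      where
      open ≡-Reasoning
      uniq : Unique (map f (filterᵇ p xs))
      uniq = Unique-map⁺-retract (λ z∈ → let x∈ , px = ∈-filter⁻ _ z∈ in let _ , _ , gf = to x∈ px in gf) (Unique.filter⁺ _ uxs)
      sameMembers : map f (filterᵇ p xs) ∼[ set ] filterᵇ q ys
      sameMembers = mk⇔ forth back
        where
        forth : ∀ {y} → y ∈ map f (filterᵇ p xs) → y ∈ filterᵇ q ys
        forth y∈ with x , x∈ , refl ← ∈-map⁻ f y∈ with x∈xs , px ← ∈-filter⁻ _ x∈ with fx∈ , qfx , _ ← to x∈xs px = ∈-filter⁺ _ fx∈ qfx
        back : ∀ {y} → y ∈ filterᵇ q ys → y ∈ map f (filterᵇ p xs)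
        back y∈ with y∈ys , qy ← ∈-filter⁻ _ y∈ with gy∈ , pgy , fgy ← from y∈ys qy = subst (_∈ _) fgy (∈-map⁺ f (∈-filter⁺ _ gy∈ pgy))

  listsUpTo-suc : {A : Set} (L : ℕ) (xs : List A) → listsUpTo (suc L) xs ≡ [] ∷ cartesianProductWith _∷_ xs (listsUpTo L xs)
  listsUpTo-suc L xs = cong ([] ∷_) (go xs)
    where
    go : ∀ ys → concatMap (λ y → map (y ∷_) (listsUpTo L xs)) ys ≡ cartesianProductWith _∷_ ys (listsUpTo L xs)
    go [] = refl
    go (y ∷ ys) = cong (map (y ∷_) (listsUpTo L xs) ++_) (go ys)

  listsUpTo-unique : {A : Set} (L : ℕ) {xs : List A} → Unique xs → Unique (listsUpTo L xs)
  listsUpTo-unique zero u = [] ∷ []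
  listsUpTo-unique (suc L) {xs} u rewrite listsUpTo-suc L xs =
    All.tabulate nonEmpty ∷ Unique.cartesianProductWith⁺ _∷_ ∷-injective u (listsUpTo-unique L u)
    where
    nonEmpty : ∀ {ℓ} → ℓ ∈ cartesianProductWith _∷_ xs (listsUpTo L xs) → [] ≢ ℓ
    nonEmpty ℓ∈ with _ , _ , _ , _ , refl ← ∈-cartesianProductWith⁻ _∷_ xs (listsUpTo L xs) ℓ∈ = λ ()

  ∈-listsUpTo⁺ : {A : Set} {L : ℕ} {xs ℓ : List A} → length ℓ ≤ L → All (_∈ xs) ℓ → ℓ ∈ listsUpTo L xs
  ∈-listsUpTo⁺ {L = zero} {ℓ = []} _ _ = here refl
  ∈-listsUpTo⁺ {L = suc L} {ℓ = []} _ _ = here refl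
  ∈-listsUpTo⁺ {L = suc L} {xs} {a ∷ ℓ} (s≤s len) (a∈ ∷ ℓ⊆) rewrite listsUpTo-suc L xs =
    there (∈-cartesianProductWith⁺ _∷_ a∈ (∈-listsUpTo⁺ len ℓ⊆))

  range-unique : (n : ℕ) → Unique (range n)
  range-unique n = Unique.upTo⁺ (suc n)

  ∈-range⁺ : {i n : ℕ} → i ≤ n → i ∈ range n
  ∈-range⁺ i≤n = ∈-upTo⁺ (s≤s i≤n)

  count-≡ᵇ-range : {c M : ℕ} → c ≤ M → count (c ≡ᵇ_) (range M) ≡ 1
  count-≡ᵇ-range {c} {M} c≤M = count-bijection (λ x → x) (λ x → x) {p = c ≡ᵇ_} {q = λ _ → true} {ys = c ∷ []}
    (range-unique M) (All.[] ∷ [])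
    (λ {x} _ c≡x → here (sym (ℕ.≡ᵇ⇒≡ c x c≡x)) , _ , refl)
    (λ { (here refl) _ → ∈-range⁺ c≤M , ℕ.≡⇒≡ᵇ c c refl , refl })

  ≥-trans : {a b c : ℕ} → a ≥ b → b ≥ c → a ≥ c
  ≥-trans a≥b b≥c = ℕ.≤-trans b≥c a≥b

  maxL-≤ : {x : ℕ} (xs : List ℕ) → All (_≤ x) xs → maxL xs ≤ x
  maxL-≤ [] [] = z≤n
  maxL-≤ (y ∷ ys) (y≤x ∷ ys≤x) = ℕ.⊔-lub y≤x (maxL-≤ ys ys≤x)

  maxL-sorted : {x : ℕ} {xs : List ℕ} → Linked _≥_ (x ∷ xs) → maxL (x ∷ xs) ≡ x
  maxL-sorted {x} {xs} sorted with All.uncons (Linked⇒All ≥-trans ℕ.≤-refl sorted)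
  ... | _ , xs≤x = ℕ.m≥n⇒m⊔n≡m (maxL-≤ xs xs≤x)

  maxL-upper : (xs : List ℕ) → All (_≤ maxL xs) xs
  maxL-upper [] = []
  maxL-upper (x ∷ xs) = ℕ.m≤m⊔n x (maxL xs) ∷ All.map (λ y≤ → ℕ.≤-trans y≤ (ℕ.m≤n⊔m x (maxL xs))) (maxL-upper xs)

  length≤sum : (xs : List ℕ) → All (1 ≤_) xs → length xs ≤ sum xs
  length≤sum [] [] = z≤n
  length≤sum (x ∷ xs) (1≤x ∷ pos) = ℕ.+-mono-≤ 1≤x (length≤sum xs pos)

  ∈-listsUpTo-range : {n : ℕ} (xs : List ℕ) → All (1 ≤_) xs → sum xs ≤ n → xs ∈ listsUpTo n (range n)
  ∈-listsUpTo-range xs pos sum≤n =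
    ∈-listsUpTo⁺ (ℕ.≤-trans (length≤sum xs pos) sum≤n) (All.map (∈-range⁺ ∘ (λ x≤ → ℕ.≤-trans x≤ sum≤n)) (parts≤sum xs))
    where
    parts≤sum : (xs : List ℕ) → All (_≤ sum xs) xs
    parts≤sum [] = []
    parts≤sum (x ∷ xs) = ℕ.m≤m+n x (sum xs) ∷ All.map (λ y≤ → ℕ.≤-trans y≤ (ℕ.m≤n+m (sum xs) x)) (parts≤sum xs)

  sum-replicate : (m c : ℕ) → sum (replicate m c) ≡ m * c
  sum-replicate zero c = refl
  sum-replicate (suc m) c = cong (_+_ c) (sum-replicate m c)

  replicate-sorted : (m c : ℕ) → AllPairs _≥_ (replicate m c)
  replicate-sorted zero c = []
  replicate-sorted (suc m) c = All.replicate⁺ m ℕ.≤-refl ∷ replicate-sorted m c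

  multiplicity : ℕ → List ℕ → ℕ
  multiplicity c = count (_≡ᵇ c)

  multiplicity-absent : {c : ℕ} (xs : List ℕ) → All (_≢ c) xs → multiplicity c xs ≡ 0
  multiplicity-absent {c} xs ≢c = count-none (_≡ᵇ c) (All.map (λ {x} x≢c → x≢c ∘ ℕ.≡ᵇ⇒≡ x c) ≢c)

  multiplicity-replicate : (m c : ℕ) → multiplicity c (replicate m c) ≡ m
  multiplicity-replicate zero c = refl
  multiplicity-replicate (suc m) c rewrite ≡ᵇ-refl c = cong suc (multiplicity-replicate m c)

  multiplicity-∈ : {c : ℕ} (xs : List ℕ) → 0 < multiplicity c xs → c ∈ xs
  multiplicity-∈ {c} (x ∷ xs) pos with x ≡ᵇ c in eq
  ... | true = here (sym (ℕ.≡ᵇ⇒≡ x c (subst T (sym eq) _)))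
  ... | false = there (multiplicity-∈ xs pos)

  multiplicity-∷-cancel : {c x : ℕ} (xs ys : List ℕ) →
    multiplicity c (x ∷ xs) ≡ multiplicity c (x ∷ ys) → multiplicity c xs ≡ multiplicity c ys
  multiplicity-∷-cancel {c} {x} xs ys eq with x ≡ᵇ c
  ... | true = ℕ.suc-injective eq
  ... | false = eq

  multiplicity-self : (x : ℕ) (xs : List ℕ) → 0 < multiplicity x (x ∷ xs)
  multiplicity-self x xs rewrite ≡ᵇ-refl x = s≤s z≤n

  sorted-≤-head : {y c : ℕ} {ys : List ℕ} → AllPairs _≥_ (y ∷ ys) → c ∈ y ∷ ys → c ≤ y
  sorted-≤-head _ (here refl) = ℕ.≤-refl
  sorted-≤-head (y≥ ∷ _) (there c∈) = All.lookup y≥ c∈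

  sorted-by-multiplicities : {xs ys : List ℕ} → AllPairs _≥_ xs → AllPairs _≥_ ys →
    (∀ c → multiplicity c xs ≡ multiplicity c ys) → xs ≡ ys
  sorted-by-multiplicities {[]} {[]} _ _ _ = refl
  sorted-by-multiplicities {x ∷ xs} {[]} _ _ same with () ← subst (0 <_) (same x) (multiplicity-self x xs)
  sorted-by-multiplicities {[]} {y ∷ ys} _ _ same with () ← subst (0 <_) (sym (same y)) (multiplicity-self y ys)
  sorted-by-multiplicities {x ∷ xs} {y ∷ ys} sx@(_ ∷ sxs) sy@(_ ∷ sys) same
    with ℕ.≤-antisym (sorted-≤-head sy (multiplicity-∈ (y ∷ ys) (subst (0 <_) (same x) (multiplicity-self x xs))))
                     (sorted-≤-head sx (multiplicity-∈ (x ∷ xs) (subst (0 <_) (sym (same y)) (multiplicity-self y ys))))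
  ... | refl = cong (x ∷_) (sorted-by-multiplicities sxs sys (λ c → multiplicity-∷-cancel {x = x} xs ys (same c)))

  isOdd-2* : (k : ℕ) → isOdd (2 * k) ≡ false
  isOdd-2* zero = refl
  isOdd-2* (suc k) rewrite ℕ.+-suc k (k + 0) = isOdd-2* k

  isOdd-1+2* : (k : ℕ) → isOdd (suc (2 * k)) ≡ true
  isOdd-1+2* zero = refl
  isOdd-1+2* (suc k) rewrite ℕ.+-suc k (k + 0) = isOdd-1+2* k

  isOdd-suc : (a : ℕ) → isOdd (suc a) ≡ not (isOdd a)
  isOdd-suc zero = refl
  isOdd-suc (suc zero) = refl
  isOdd-suc (suc (suc a)) = isOdd-suc a

  even-half : (c : ℕ) → isOdd c ≡ false → Σ ℕ λ u → c ≡ 2 * u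
  even-half zero _ = 0 , refl
  even-half (suc zero) ()
  even-half (suc (suc c)) c-even with even-half c c-even
  ... | u , refl = suc u , sym (ℕ.*-suc 2 u)

  odd-successor : {a b : ℕ} → T (isOdd a) → T (isOdd b) → a ≤ b → b ≤ suc (suc a) → b ≡ a ⊎ b ≡ suc (suc a)
  odd-successor {a} {b} odd-a odd-b a≤b b≤a+2 with ℕ.m≤n⇒m<n∨m≡n b≤a+2
  ... | inj₂ b≡a+2 = inj₂ b≡a+2
  ... | inj₁ (s≤s b≤a+1) with ℕ.m≤n⇒m<n∨m≡n b≤a+1
  ...   | inj₁ (s≤s b≤a) = inj₁ (ℕ.≤-antisym b≤a a≤b)
  ...   | inj₂ refl = ⊥-elim (subst T (trans (isOdd-suc a) (cong not (Equivalence.to T-≡ odd-a))) odd-b)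

  odds-positive : {os : List ℕ} → All (T ∘ isOdd) os → All (1 ≤_) os
  odds-positive = All.map λ {o} → odd⇒positive o
    where
    odd⇒positive : ∀ o → T (isOdd o) → 1 ≤ o
    odd⇒positive (suc o) _ = s≤s z≤n

  2*-mono-< : {u v : ℕ} → u < v → 2 * u < 2 * v
  2*-mono-< = ℕ.*-monoʳ-< 2

  <∸1⇒suc< : {i k : ℕ} → i < k ∸ 1 → suc i < k
  <∸1⇒suc< {k = suc k} i<k = s≤s i<k

  parityIs : Bool → ℕ → Bool
  parityIs true m = isOdd m
  parityIs false m = not (isOdd m)

  parityIs-≡ : (par : Bool) (m : ℕ) → T (parityIs par m) ⇔ isOdd m ≡ par
  parityIs-≡ true m = T-≡
  parityIs-≡ false m = T-not-≡

  -- Signed sums over words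

  ∑ : {A : Set} → List A → (A → ℤ) → ℤ
  ∑ [] h = 0ℤ
  ∑ (x ∷ xs) h = h x +ℤ ∑ xs h

  ∑-syntax : {A : Set} → List A → (A → ℤ) → ℤ
  ∑-syntax = ∑

  infix 5 ∑-syntax
  syntax ∑-syntax xs (λ x → e) = ∑[ x ← xs ] e

  module _ {A : Set} where

    ∑-++ : (xs ys : List A) (h : A → ℤ) → ∑ (xs ++ ys) h ≡ ∑ xs h +ℤ ∑ ys h
    ∑-++ [] ys h = sym (ℤ.+-identityˡ _)
    ∑-++ (x ∷ xs) ys h = trans (cong (h x +ℤ_) (∑-++ xs ys h)) (sym (ℤ.+-assoc (h x) _ _))

    ∑-cong : (xs : List A) {h h′ : A → ℤ} → (∀ x → h x ≡ h′ x) → ∑ xs h ≡ ∑ xs h′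
    ∑-cong [] e = refl
    ∑-cong (x ∷ xs) e = cong₂ _+ℤ_ (e x) (∑-cong xs e)

    ∑-*ˡ : (c : ℤ) (xs : List A) (h : A → ℤ) → ∑[ x ← xs ] c *ℤ h x ≡ c *ℤ ∑ xs h
    ∑-*ˡ c [] h = sym (ℤ.*-zeroʳ c)
    ∑-*ˡ c (x ∷ xs) h = trans (cong (c *ℤ h x +ℤ_) (∑-*ˡ c xs h)) (sym (ℤ.*-distribˡ-+ c (h x) _))

  ∑-map : {A B : Set} (f : A → B) (xs : List A) (h : B → ℤ) → ∑ (map f xs) h ≡ ∑[ x ← xs ] h (f x)
  ∑-map f [] h = refl
  ∑-map f (x ∷ xs) h = cong (h (f x) +ℤ_) (∑-map f xs h)

  ∑-cartesianProductWith : {A B C : Set} (f : A → B → C) (xs : List A) (ys : List B) (h : C → ℤ) →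
    ∑ (cartesianProductWith f xs ys) h ≡ ∑[ x ← xs ] ∑[ y ← ys ] h (f x y)
  ∑-cartesianProductWith f [] ys h = refl
  ∑-cartesianProductWith f (x ∷ xs) ys h =
    trans (∑-++ (map (f x) ys) _ h) (cong₂ _+ℤ_ (∑-map (f x) ys h) (∑-cartesianProductWith f xs ys h))

  when : Bool → ℤ → ℤ
  when true x = x
  when false x = 0ℤ

  when-*ˡ : (b : Bool) (c x : ℤ) → when b (c *ℤ x) ≡ c *ℤ when b x
  when-*ˡ true c x = refl
  when-*ˡ false c x = sym (ℤ.*-zeroʳ c)

  when-∧ : (a b : Bool) (x : ℤ) → when (a ∧ b) x ≡ when a (when b x)
  when-∧ true b x = refl
  when-∧ false b x = refl

  ∑-when : {A : Set} (b : Bool) (xs : List A) (h : A → ℤ) → ∑[ x ← xs ] when b (h x) ≡ when b (∑ xs h)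
  ∑-when true xs h = refl
  ∑-when false [] h = refl
  ∑-when false (x ∷ xs) h = trans (ℤ.+-identityˡ _) (∑-when false xs h)

  count-∑ : {A : Set} (p : A → Bool) (xs : List A) → + count p xs ≡ ∑[ x ← xs ] when (p x) 1ℤ
  count-∑ p [] = refl
  count-∑ p (x ∷ xs) with p x
  ... | true = cong (1ℤ +ℤ_) (count-∑ p xs)
  ... | false = trans (count-∑ p xs) (sym (ℤ.+-identityˡ _))

  sign-parity : (m : ℕ) → -1ℤ ^ m ≡ (if isOdd m then -1ℤ else 1ℤ)
  sign-parity zero = refl
  sign-parity (suc zero) = refl
  sign-parity (suc (suc m)) = trans (twice (-1ℤ ^ m)) (sign-parity m)
    where
    twice : ∀ s → -1ℤ *ℤ (-1ℤ *ℤ s) ≡ s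
    twice = solve-∀

  sign-square : (m : ℕ) → -1ℤ ^ m *ℤ -1ℤ ^ m ≡ 1ℤ
  sign-square zero = refl
  sign-square (suc m) = trans (square (-1ℤ ^ m)) (sign-square m)
    where
    square : ∀ s → -1ℤ *ℤ s *ℤ (-1ℤ *ℤ s) ≡ s *ℤ s
    square = solve-∀

  ∑-sub : {A : Set} (xs : List A) (f g : A → ℤ) → ∑ xs f - ∑ xs g ≡ ∑[ x ← xs ] (f x - g x)
  ∑-sub [] f g = refl
  ∑-sub (x ∷ xs) f g = trans (regroup (f x) (g x) (∑ xs f) (∑ xs g)) (cong (f x - g x +ℤ_) (∑-sub xs f g))
    where
    regroup : ∀ a b c d → a +ℤ c - (b +ℤ d) ≡ a - b +ℤ (c - d)
    regroup = solve-∀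

  signed-count : {A : Set} (B : A → Bool) (m : A → ℕ) (xs : List A) →
    + count (λ x → B x ∧ parityIs true (m x)) xs - + count (λ x → B x ∧ parityIs false (m x)) xs ≡ - (∑[ x ← xs ] when (B x) (-1ℤ ^ m x))
  signed-count {A} B m xs = begin
    + count odd xs - + count even xs
      ≡⟨ cong₂ _-_ (count-∑ odd xs) (count-∑ even xs) ⟩
    (∑[ x ← xs ] when (odd x) 1ℤ) - (∑[ x ← xs ] when (even x) 1ℤ)
      ≡⟨ ∑-sub xs _ _ ⟩
    ∑[ x ← xs ] (when (odd x) 1ℤ - when (even x) 1ℤ)
      ≡⟨ ∑-cong xs (λ x → pointwise (B x) (m x)) ⟩
    ∑[ x ← xs ] -1ℤ *ℤ when (B x) (-1ℤ ^ m x)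
      ≡⟨ ∑-*ˡ -1ℤ xs _ ⟩
    -1ℤ *ℤ (∑[ x ← xs ] when (B x) (-1ℤ ^ m x))
      ≡⟨ ℤ.-1*i≡-i _ ⟩
    - (∑[ x ← xs ] when (B x) (-1ℤ ^ m x)) ∎
    where
    open ≡-Reasoning
    odd even : A → Bool
    odd x = B x ∧ parityIs true (m x)
    even x = B x ∧ parityIs false (m x)
    pointwise : (b : Bool) (m : ℕ) → when (b ∧ isOdd m) 1ℤ - when (b ∧ not (isOdd m)) 1ℤ ≡ -1ℤ *ℤ when b (-1ℤ ^ m)
    pointwise false m = refl
    pointwise true m rewrite sign-parity m with isOdd m
    ... | true = refl
    ... | false = refl

  module WeightedWords {Letter : Set} (size : ℕ → Letter → ℕ) (tags : Letter → ℕ) (sign : Letter → ℤ) where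

    wordSize : ℕ → List Letter → ℕ
    wordSize v [] = 0
    wordSize v (x ∷ word) = size v x + wordSize (suc v) word

    wordTags : List Letter → ℕ
    wordTags [] = 0
    wordTags (x ∷ word) = tags x + wordTags word

    wordSign : List Letter → ℤ
    wordSign [] = 1ℤ
    wordSign (x ∷ word) = sign x *ℤ wordSign word

    -- The coefficient of t^j q^w in the signed monomial of a word whose first letter sits at
    -- position v; `gf` sums it over all words of length at most L.
    coeff : ℕ → ℕ → ℕ → List Letter → ℤ
    coeff v j w word = when ((wordTags word ≡ᵇ j) ∧ (wordSize v word ≡ᵇ w)) (wordSign word)

    coeff-∷ : (v j w : ℕ) (x : Letter) (word : List Letter) →
      coeff v j w (x ∷ word) ≡ sign x *ℤ when ((tags x ≤ᵇ j) ∧ (size v x ≤ᵇ w)) (coeff (suc v) (j ∸ tags x) (w ∸ size v x) word)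
    coeff-∷ v j w x word = begin
      when ((tags x + wordTags word ≡ᵇ j) ∧ (size v x + wordSize (suc v) word ≡ᵇ w)) (sign x *ℤ wordSign word)
        ≡⟨ cong₂ (λ a b → when (a ∧ b) _) (≡ᵇ-+ (tags x) (wordTags word) j) (≡ᵇ-+ (size v x) (wordSize (suc v) word) w) ⟩
      when ((A₁ ∧ B₁) ∧ (A₂ ∧ B₂)) (sign x *ℤ wordSign word)
        ≡⟨ cong (λ c → when c _) (∧-interchange A₁ B₁ A₂ B₂) ⟩
      when ((A₁ ∧ A₂) ∧ (B₁ ∧ B₂)) (sign x *ℤ wordSign word)
        ≡⟨ when-∧ (A₁ ∧ A₂) (B₁ ∧ B₂) _ ⟩
      when (A₁ ∧ A₂) (when (B₁ ∧ B₂) (sign x *ℤ wordSign word))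
        ≡⟨ cong (when (A₁ ∧ A₂)) (when-*ˡ (B₁ ∧ B₂) (sign x) _) ⟩
      when (A₁ ∧ A₂) (sign x *ℤ when (B₁ ∧ B₂) (wordSign word))
        ≡⟨ when-*ˡ (A₁ ∧ A₂) (sign x) _ ⟩
      sign x *ℤ when (A₁ ∧ A₂) (coeff (suc v) (j ∸ tags x) (w ∸ size v x) word) ∎
      where
      open ≡-Reasoning
      A₁ = tags x ≤ᵇ j
      A₂ = size v x ≤ᵇ w
      B₁ = wordTags word ≡ᵇ j ∸ tags x
      B₂ = wordSize (suc v) word ≡ᵇ w ∸ size v x

    wordTags-++ : (xs ys : List Letter) → wordTags (xs ++ ys) ≡ wordTags xs + wordTags ys
    wordTags-++ [] ys = refl
    wordTags-++ (x ∷ xs) ys = trans (cong (_+_ (tags x)) (wordTags-++ xs ys)) (sym (ℕ.+-assoc (tags x) _ _))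

    wordSize-++ : (v : ℕ) (xs ys : List Letter) → wordSize v (xs ++ ys) ≡ wordSize v xs + wordSize (v + length xs) ys
    wordSize-++ v [] ys = cong (λ u → wordSize u ys) (sym (ℕ.+-identityʳ v))
    wordSize-++ v (x ∷ xs) ys = begin
      size v x + wordSize (suc v) (xs ++ ys)                       ≡⟨ cong (_+_ (size v x)) (wordSize-++ (suc v) xs ys) ⟩
      size v x + (wordSize (suc v) xs + wordSize (suc v + length xs) ys) ≡⟨ ℕ.+-assoc (size v x) _ _ ⟨
      size v x + wordSize (suc v) xs + wordSize (suc v + length xs) ys
        ≡⟨ cong (λ u → size v x + wordSize (suc v) xs + wordSize u ys) (ℕ.+-suc v (length xs)) ⟨
      size v x + wordSize (suc v) xs + wordSize (v + length (x ∷ xs)) ys ∎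
      where open ≡-Reasoning

    gf : List Letter → ℕ → ℕ → ℕ → ℕ → ℤ
    gf alphabet L v j w = ∑[ word ← listsUpTo L alphabet ] coeff v j w word

    gf-suc : (alphabet : List Letter) (L v j w : ℕ) →
      gf alphabet (suc L) v j w ≡
      coeff v j w [] +ℤ
        (∑[ x ← alphabet ] sign x *ℤ when ((tags x ≤ᵇ j) ∧ (size v x ≤ᵇ w)) (gf alphabet L (suc v) (j ∸ tags x) (w ∸ size v x)))
    gf-suc alphabet L v j w =
      trans (cong (λ words → ∑ words (coeff v j w)) (listsUpTo-suc L alphabet))
        (cong (coeff v j w [] +ℤ_)
          (trans (∑-cartesianProductWith _∷_ alphabet (listsUpTo L alphabet) (coeff v j w)) (∑-cong alphabet letter)))
      where
      letter : ∀ x → ∑[ word ← listsUpTo L alphabet ] coeff v j w (x ∷ word) ≡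
                     sign x *ℤ when ((tags x ≤ᵇ j) ∧ (size v x ≤ᵇ w)) (gf alphabet L (suc v) (j ∸ tags x) (w ∸ size v x))
      letter x = trans (∑-cong (listsUpTo L alphabet) (coeff-∷ v j w x))
                  (trans (∑-*ˡ (sign x) (listsUpTo L alphabet) _)
                    (cong (sign x *ℤ_) (∑-when _ (listsUpTo L alphabet) _)))

  ∑-range-suc : (a : ℕ) (h : ℕ → ℤ) → ∑ (range (suc a)) h ≡ ∑ (range a) h +ℤ h (suc a)
  ∑-range-suc a h = begin
    ∑ (range (suc a)) h               ≡⟨ cong (λ xs → ∑ xs h) (upTo-∷ʳ (suc a)) ⟨
    ∑ (range a ++ suc a ∷ []) h       ≡⟨ ∑-++ (range a) (suc a ∷ []) h ⟩
    ∑ (range a) h +ℤ (h (suc a) +ℤ 0ℤ) ≡⟨ cong (∑ (range a) h +ℤ_) (ℤ.+-identityʳ (h (suc a))) ⟩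
    ∑ (range a) h +ℤ h (suc a)        ∎
    where open ≡-Reasoning

  -- The two alphabets and the transfer identity

  bit : Bool → ℕ
  bit false = 0
  bit true = 1

  nonzero : ℕ → ℕ
  nonzero zero = 0
  nonzero (suc _) = 1

  -- The letter (m , b) at position v: the even part 2v occurs m times, and the v-th largest odd
  -- part exceeds the (v+1)-th largest by 2 · bit b.
  OELetter : Set
  OELetter = ℕ × Bool

  oeSize : ℕ → OELetter → ℕ
  oeSize v (m , b) = suc ((m + bit b) * (2 * v))

  oeTag : OELetter → ℕ
  oeTag (m , _) = nonzero m

  oeSign : OELetter → ℤ
  oeSign (m , _) = -1ℤ ^ m

  oeLetters : ℕ → List OELetter
  oeLetters n = cartesianProduct (range n) (false ∷ true ∷ [])

  module OE = WeightedWords oeSize oeTag oeSign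

  -- The cell at position v says whether v is a part of the row, and whether it is the largest
  -- part M_j of its mark j < k.
  data Cell : Set where
    absent present present-max : Cell

  cellWeight : Cell → ℕ
  cellWeight absent = 0
  cellWeight _ = 1

  cellSize : ℕ → Cell → ℕ
  cellSize v c = suc (cellWeight c * (2 * v))

  cellTag : Cell → ℕ
  cellTag present-max = 1
  cellTag _ = 0

  cells : List Cell
  cells = absent ∷ present ∷ present-max ∷ []

  module SC = WeightedWords cellSize cellTag (λ _ → 1ℤ)

  ∑-oeLetters-telescopes : (K : ℕ → ℕ → ℤ) (a : ℕ) →
    ∑[ x ← oeLetters a ] oeSign x *ℤ K (proj₁ x + bit (proj₂ x)) (oeTag x) ≡ K 0 0 +ℤ K 1 0 - K 1 1 +ℤ -1ℤ ^ a *ℤ K (suc a) 1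
  ∑-oeLetters-telescopes K a =
    trans (∑-cartesianProductWith _,_ (range a) (false ∷ true ∷ []) (λ x → oeSign x *ℤ K (proj₁ x + bit (proj₂ x)) (oeTag x)))
          (telescope a)
    where
    pair : ℕ → ℤ
    pair m = -1ℤ ^ m *ℤ K (m + 0) (nonzero m) +ℤ (-1ℤ ^ m *ℤ K (m + 1) (nonzero m) +ℤ 0ℤ)
    telescope : (a : ℕ) → ∑ (range a) pair ≡ K 0 0 +ℤ K 1 0 - K 1 1 +ℤ -1ℤ ^ a *ℤ K (suc a) 1
    telescope zero = base (K 0 0) (K 1 0) (K 1 1)
      where
      base : ∀ x y z → 1ℤ *ℤ x +ℤ (1ℤ *ℤ y +ℤ 0ℤ) +ℤ 0ℤ ≡ x +ℤ y - z +ℤ 1ℤ *ℤ z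
      base = solve-∀
    telescope (suc a) = begin
      ∑ (range (suc a)) pair ≡⟨ ∑-range-suc a pair ⟩
      ∑ (range a) pair +ℤ pair (suc a) ≡⟨ cong (_+ℤ pair (suc a)) (telescope a) ⟩
      K 0 0 +ℤ K 1 0 - K 1 1 +ℤ -1ℤ ^ a *ℤ K (suc a) 1 +ℤ pair (suc a)
        ≡⟨ cong₂ (λ p q → K 0 0 +ℤ K 1 0 - K 1 1 +ℤ -1ℤ ^ a *ℤ K (suc a) 1 +ℤ (-1ℤ ^ suc a *ℤ K p 1 +ℤ (-1ℤ ^ suc a *ℤ K q 1 +ℤ 0ℤ)))
                 (ℕ.+-identityʳ (suc a)) (ℕ.+-comm (suc a) 1) ⟩
      K 0 0 +ℤ K 1 0 - K 1 1 +ℤ -1ℤ ^ a *ℤ K (suc a) 1 +ℤ (-1ℤ ^ suc a *ℤ K (suc a) 1 +ℤ (-1ℤ ^ suc a *ℤ K (suc (suc a)) 1 +ℤ 0ℤ))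
        ≡⟨ cancel (K 0 0) (K 1 0) (K 1 1) (K (suc a) 1) (K (suc (suc a)) 1) (-1ℤ ^ a) ⟩
      K 0 0 +ℤ K 1 0 - K 1 1 +ℤ -1ℤ ^ suc a *ℤ K (suc (suc a)) 1 ∎
      where
      open ≡-Reasoning
      cancel : ∀ x y z u t s → x +ℤ y - z +ℤ s *ℤ u +ℤ (-1ℤ *ℤ s *ℤ u +ℤ (-1ℤ *ℤ s *ℤ t +ℤ 0ℤ)) ≡ x +ℤ y - z +ℤ -1ℤ *ℤ s *ℤ t
      cancel = solve-∀

  when-0≡ᵇ : (j : ℕ) (b : Bool) (x : ℤ) → when ((0 ≡ᵇ j) ∧ b) x ≡ -1ℤ ^ j *ℤ when ((0 ≡ᵇ j) ∧ b) x
  when-0≡ᵇ zero b x = sym (ℤ.*-identityˡ _)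
  when-0≡ᵇ (suc j) b x = sym (ℤ.*-zeroʳ (-1ℤ ^ suc j))

  topLetter-exceeds : (n v w : ℕ) → 1 ≤ v → w ≤ n → (suc (suc n * (2 * v)) ≤ᵇ w) ≡ false
  topLetter-exceeds n (suc v) w _ w≤n = <⇒≤ᵇ≡false (s≤s (ℕ.≤-trans w≤n (ℕ.≤-trans (ℕ.n≤1+n n) (ℕ.m≤m*n (suc n) (2 * suc v)))))

  neg-when-sign : (j : ℕ) (b : Bool) (g : ℕ → ℤ) →
    - when ((1 ≤ᵇ j) ∧ b) (-1ℤ ^ (j ∸ 1) *ℤ g (j ∸ 1)) ≡ -1ℤ ^ j *ℤ when ((1 ≤ᵇ j) ∧ b) (g (j ∸ 1))
  neg-when-sign zero b g = refl
  neg-when-sign (suc j) true g = flip (-1ℤ ^ j) (g j)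
    where
    flip : ∀ s x → - (s *ℤ x) ≡ -1ℤ *ℤ s *ℤ x
    flip = solve-∀
  neg-when-sign (suc j) false g = sym (ℤ.*-zeroʳ (-1ℤ ^ suc j))

  oe-coeff-[] : (v j w : ℕ) → OE.coeff v j w [] ≡ -1ℤ ^ j *ℤ SC.coeff v j w []
  oe-coeff-[] v j w = when-0≡ᵇ j (0 ≡ᵇ w) 1ℤ

  oe-gf≡±sc-gf : (n L v j w : ℕ) → 1 ≤ v → w ≤ n → OE.gf (oeLetters n) L v j w ≡ -1ℤ ^ j *ℤ SC.gf cells L v j w
  oe-gf≡±sc-gf n zero v j w _ _ =
    trans (ℤ.+-identityʳ _) (trans (oe-coeff-[] v j w) (cong (-1ℤ ^ j *ℤ_) (sym (ℤ.+-identityʳ _))))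
  oe-gf≡±sc-gf n (suc L) v j w 1≤v w≤n = begin
    OE.gf (oeLetters n) (suc L) v j w
      ≡⟨ OE.gf-suc (oeLetters n) L v j w ⟩
    OE.coeff v j w [] +ℤ (∑[ x ← oeLetters n ] oeSign x *ℤ H x)
      ≡⟨ cong (OE.coeff v j w [] +ℤ_) (∑-cong (oeLetters n) λ x → cong (oeSign x *ℤ_) (inductionStep x)) ⟩
    OE.coeff v j w [] +ℤ (∑[ x ← oeLetters n ] oeSign x *ℤ K (proj₁ x + bit (proj₂ x)) (oeTag x))
      ≡⟨ cong (OE.coeff v j w [] +ℤ_) (∑-oeLetters-telescopes K n) ⟩
    OE.coeff v j w [] +ℤ (K 0 0 +ℤ K 1 0 - K 1 1 +ℤ -1ℤ ^ n *ℤ K (suc n) 1)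
      ≡⟨ cong (λ t → OE.coeff v j w [] +ℤ (K 0 0 +ℤ K 1 0 - K 1 1 +ℤ -1ℤ ^ n *ℤ t)) K-top ⟩
    OE.coeff v j w [] +ℤ (K 0 0 +ℤ K 1 0 - K 1 1 +ℤ -1ℤ ^ n *ℤ 0ℤ)
      ≡⟨ cong₂ (λ c k → c +ℤ (k +ℤ -1ℤ ^ n *ℤ 0ℤ)) (oe-coeff-[] v j w) (cong₂ _+ℤ_ (cong₂ _+ℤ_ K-absent K-present) K-max) ⟩
    s *ℤ SC.coeff v j w [] +ℤ (s *ℤ G absent +ℤ s *ℤ G present +ℤ s *ℤ G present-max +ℤ -1ℤ ^ n *ℤ 0ℤ)
      ≡⟨ collect (SC.coeff v j w []) (G absent) (G present) (G present-max) (-1ℤ ^ n) s ⟩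
    s *ℤ (SC.coeff v j w [] +ℤ (∑[ c ← cells ] 1ℤ *ℤ G c))
      ≡⟨ cong (s *ℤ_) (SC.gf-suc cells L v j w) ⟨
    s *ℤ SC.gf cells (suc L) v j w ∎
    where
    open ≡-Reasoning
    s = -1ℤ ^ j
    fits : ℕ → ℕ → Bool
    fits tag size = (tag ≤ᵇ j) ∧ (size ≤ᵇ w)
    K : ℕ → ℕ → ℤ
    K t tag = when (fits tag (suc (t * (2 * v)))) (-1ℤ ^ (j ∸ tag) *ℤ SC.gf cells L (suc v) (j ∸ tag) (w ∸ suc (t * (2 * v))))
    H : OELetter → ℤ
    H x = when (fits (oeTag x) (oeSize v x)) (OE.gf (oeLetters n) L (suc v) (j ∸ oeTag x) (w ∸ oeSize v x))
    G : Cell → ℤ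
    G c = when (fits (cellTag c) (cellSize v c)) (SC.gf cells L (suc v) (j ∸ cellTag c) (w ∸ cellSize v c))
    inductionStep : (x : OELetter) →
      H x ≡ K (proj₁ x + bit (proj₂ x)) (oeTag x)
    inductionStep x =
      cong (when _) (oe-gf≡±sc-gf n L (suc v) (j ∸ oeTag x) (w ∸ oeSize v x) (s≤s z≤n) (ℕ.≤-trans (ℕ.m∸n≤m w (oeSize v x)) w≤n))
    K-top : K (suc n) 1 ≡ 0ℤ
    K-top = cong (λ b → when b (-1ℤ ^ (j ∸ 1) *ℤ SC.gf cells L (suc v) (j ∸ 1) (w ∸ suc (suc n * (2 * v)))))
                 (trans (cong ((1 ≤ᵇ j) ∧_) (topLetter-exceeds n v w 1≤v w≤n)) (∧-zeroʳ (1 ≤ᵇ j)))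
    K-absent : K 0 0 ≡ s *ℤ G absent
    K-absent = when-*ˡ (fits 0 (cellSize v absent)) s _
    K-present : K 1 0 ≡ s *ℤ G present
    K-present = when-*ˡ (fits 0 (cellSize v present)) s _
    K-max : - K 1 1 ≡ s *ℤ G present-max
    K-max = neg-when-sign j (suc (1 * (2 * v)) ≤ᵇ w) (λ i → SC.gf cells L (suc v) i (w ∸ suc (1 * (2 * v))))
    collect : ∀ c a p m t s → s *ℤ c +ℤ (s *ℤ a +ℤ s *ℤ p +ℤ s *ℤ m +ℤ t *ℤ 0ℤ) ≡ s *ℤ (c +ℤ (1ℤ *ℤ a +ℤ (1ℤ *ℤ p +ℤ (1ℤ *ℤ m +ℤ 0ℤ))))
    collect = solve-∀

  scWordSign : (word : List Cell) → SC.wordSign word ≡ 1ℤ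
  scWordSign [] = refl
  scWordSign (_ ∷ word) = trans (ℤ.*-identityˡ _) (scWordSign word)

  -- The ω and ε objects as words

  record OddParts (k : ℕ) (os : List ℕ) : Set where
    field
      odd : All (T ∘ isOdd) os
      sorted : Linked _≥_ os
      enough : k ≤ length os
      gapless : ∀ {v} → T (isOdd v) → v < maxL os → v ∈ os

  record EvenParts (k numOdd : ℕ) (es : List ℕ) : Set where
    field
      positive : All (1 ≤_) es
      even : All (λ e → isOdd e ≡ false) es
      sorted : Linked _≥_ es
      distinct : distinctCount es ≡ k ∸ 1
      small : All (_< 2 * numOdd) es

  T-oddPartOK : {k : ℕ} {os : List ℕ} → T (oddPartOK k os) ⇔ OddParts k os
  T-oddPartOK {k} {os} = mk⇔ to from
    where
    gap : ℕ → Bool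
    gap v = not (isOdd v ∧ (v <ᵇ maxL os)) ∨ elem v os
    to : T (oddPartOK k os) → OddParts k os
    to t = let odd , t = T-∧⁻ t ; sorted , t = T-∧⁻ t ; enough , gapless = T-∧⁻ t in record
      { odd = All.all⁺ isOdd os odd
      ; sorted = Equivalence.to T-nonincreasing sorted
      ; enough = ℕ.≤ᵇ⇒≤ k (length os) enough
      ; gapless = λ {v} odd-v v<max → Equivalence.to T-elem
          (Equivalence.to T-implies (All.lookup (All.all⁺ gap (range (maxL os)) gapless) (∈-range⁺ (ℕ.<⇒≤ v<max)))
            (T-∧⁺ odd-v (ℕ.<⇒<ᵇ v<max)))
      }
    from : OddParts k os → T (oddPartOK k os)
    from o = T-∧⁺ (All.all⁻ isOdd odd) (T-∧⁺ (Equivalence.from T-nonincreasing sorted) (T-∧⁺ (ℕ.≤⇒≤ᵇ enough)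
      (All.all⁻ gap {range (maxL os)} (All.universal (λ v → Equivalence.from T-implies λ t →
        let odd-v , v<max = T-∧⁻ {isOdd v} t in Equivalence.from T-elem (gapless odd-v (ℕ.<ᵇ⇒< v (maxL os) v<max))) _))))
      where open OddParts o

  T-evenPartOK : {k numOdd : ℕ} {es : List ℕ} → T (evenPartOK k numOdd es) ⇔ EvenParts k numOdd es
  T-evenPartOK {k} {numOdd} {es} = mk⇔ to from
    where
    posEven : ℕ → Bool
    posEven e = (1 ≤ᵇ e) ∧ not (isOdd e)
    to : T (evenPartOK k numOdd es) → EvenParts k numOdd es
    to t = let pe , t = T-∧⁻ t ; sorted , t = T-∧⁻ t ; distinct , small = T-∧⁻ t
               pe = All.all⁺ posEven es pe in record
      { positive = All.map (λ {e} p → ℕ.≤ᵇ⇒≤ 1 e (proj₁ (T-∧⁻ p))) pe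
      ; even = All.map (λ p → Equivalence.to T-not-≡ (proj₂ (T-∧⁻ p))) pe
      ; sorted = Equivalence.to T-nonincreasing sorted
      ; distinct = ℕ.≡ᵇ⇒≡ _ _ distinct
      ; small = All.map (λ {e} → ℕ.<ᵇ⇒< e _) (All.all⁺ _ es small)
      }
    from : EvenParts k numOdd es → T (evenPartOK k numOdd es)
    from e = T-∧⁺ (All.all⁻ posEven (All.zipWith (λ (p , q) → T-∧⁺ (ℕ.≤⇒≤ᵇ p) (Equivalence.from T-not-≡ q)) (positive , even)))
      (T-∧⁺ (Equivalence.from T-nonincreasing sorted) (T-∧⁺ (ℕ.≡⇒≡ᵇ _ _ distinct) (All.all⁻ _ (All.map ℕ.<⇒<ᵇ small))))
      where open EvenParts e

  record OmegaEpsObject (par : Bool) (k n : ℕ) (os es : List ℕ) : Set where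
    field
      odds : OddParts k os
      evens : EvenParts k (length os) es
      parity : isOdd (length es) ≡ par
      size : sum os + sum es ≡ n

  T-isOmegaEps : {par : Bool} {k n : ℕ} {os es : List ℕ} → T (isOmegaEps par k n (os , es)) ⇔ OmegaEpsObject par k n os es
  T-isOmegaEps {par} {k} {n} {os} {es} = mk⇔ to from
    where
    object : T (oddPartOK k os) → T (evenPartOK k (length os) es) → isOdd (length es) ≡ par → T (sum os + sum es ≡ᵇ n) →
             OmegaEpsObject par k n os es
    object odds evens parity size = record
      { odds = Equivalence.to T-oddPartOK odds
      ; evens = Equivalence.to T-evenPartOK evens
      ; parity = parity
      ; size = ℕ.≡ᵇ⇒≡ _ _ size
      }
    to : T (isOmegaEps par k n (os , es)) → OmegaEpsObject par k n os es
    to t with isOdd (length es) in eq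
    ... | true with odds , t ← T-∧⁻ t with evens , t ← T-∧⁻ t with p , size ← T-∧⁻ t =
      object odds evens (trans eq (sym (Equivalence.to T-≡ p))) size
    ... | false with odds , t ← T-∧⁻ t with evens , t ← T-∧⁻ t with p , size ← T-∧⁻ t =
      object odds evens (trans eq (sym (Equivalence.to T-not-≡ p))) size
    from : OmegaEpsObject par k n os es → T (isOmegaEps par k n (os , es))
    from o with isOdd (length es) | OmegaEpsObject.parity o
    ... | true | refl = T-∧⁺ (Equivalence.from T-oddPartOK odds) (T-∧⁺ (Equivalence.from T-evenPartOK evens) (T-∧⁺ _ (ℕ.≡⇒≡ᵇ _ _ size)))
      where open OmegaEpsObject o
    ... | false | refl = T-∧⁺ (Equivalence.from T-oddPartOK odds) (T-∧⁺ (Equivalence.from T-evenPartOK evens) (T-∧⁺ _ (ℕ.≡⇒≡ᵇ _ _ size)))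
      where open OmegaEpsObject o

  stepCount : List OELetter → ℕ
  stepCount [] = 0
  stepCount ((_ , b) ∷ word) = bit b + stepCount word

  evenCount : List OELetter → ℕ
  evenCount [] = 0
  evenCount ((m , _) ∷ word) = m + evenCount word

  oeWordSign : (word : List OELetter) → OE.wordSign word ≡ -1ℤ ^ evenCount word
  oeWordSign [] = refl
  oeWordSign ((m , _) ∷ word) = trans (cong (-1ℤ ^ m *ℤ_) (oeWordSign word)) (sym (ℤ.^-distribˡ-+-* -1ℤ m (evenCount word)))

  oddParts : List OELetter → List ℕ
  oddPartsTail : List OELetter → List ℕ
  oddParts word = suc (2 * stepCount word) ∷ oddPartsTail word
  oddPartsTail [] = []
  oddPartsTail (_ ∷ word) = oddParts word

  evenParts : ℕ → List OELetter → List ℕ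
  evenParts v [] = []
  evenParts v ((m , _) ∷ word) = evenParts (suc v) word ++ replicate m (2 * v)

  oddParts-odd : (word : List OELetter) → All (T ∘ isOdd) (oddParts word)
  oddParts-odd [] = _ ∷ []
  oddParts-odd (x ∷ word) = Equivalence.from T-≡ (isOdd-1+2* (stepCount (x ∷ word))) ∷ oddParts-odd word

  oddParts-sorted : (word : List OELetter) → Linked _≥_ (oddParts word)
  oddParts-sorted [] = [-]
  oddParts-sorted ((_ , b) ∷ word) = s≤s (ℕ.*-monoʳ-≤ 2 (ℕ.m≤n+m (stepCount word) (bit b))) ∷ oddParts-sorted word

  length-oddParts : (word : List OELetter) → length (oddParts word) ≡ suc (length word)
  length-oddParts [] = refl
  length-oddParts (_ ∷ word) = cong suc (length-oddParts word)

  oddParts-gapless : (word : List OELetter) {v : ℕ} → T (isOdd v) → v < suc (2 * stepCount word) → v ∈ oddParts word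
  oddParts-gapless [] {suc zero} _ (s≤s ())
  oddParts-gapless [] {suc (suc v)} _ (s≤s ())
  oddParts-gapless ((m , b) ∷ word) {v} odd-v v<top with ℕ.<-cmp v (suc (2 * stepCount word))
  ... | tri< v<next _ _ = there (oddParts-gapless word odd-v v<next)
  ... | tri≈ _ refl _ = there (here refl)
  ... | tri> _ _ v>next with b
  ...   | false = ⊥-elim (ℕ.<-asym v>next v<top)
  ...   | true = ⊥-elim (noOddBetween (stepCount word) odd-v v>next (subst (v <_) (cong suc (ℕ.*-suc 2 _)) v<top))
    where
    noOddBetween : ∀ c {v} → T (isOdd v) → suc (2 * c) < v → v < suc (suc (suc (2 * c))) → ⊥
    noOddBetween c odd-v lo hi with ℕ.≤-antisym (ℕ.≤-pred hi) lo
    ... | refl rewrite isOdd-2* c = odd-v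

  evenParts-≥ : (v : ℕ) (word : List OELetter) → All (2 * v ≤_) (evenParts v word)
  evenParts-≥ v [] = []
  evenParts-≥ v ((m , _) ∷ word) =
    All.++⁺ (All.map (ℕ.<⇒≤ ∘ ℕ.<-≤-trans (2*-mono-< (ℕ.n<1+n v))) (evenParts-≥ (suc v) word)) (All.replicate⁺ m ℕ.≤-refl)

  evenParts-< : (v : ℕ) (word : List OELetter) → All (_< 2 * (v + length word)) (evenParts v word)
  evenParts-< v [] = []
  evenParts-< v ((m , _) ∷ word) rewrite ℕ.+-suc v (length word) =
    All.++⁺ (evenParts-< (suc v) word) (All.replicate⁺ m (2*-mono-< (s≤s (ℕ.m≤m+n v (length word)))))

  evenParts-even : (v : ℕ) (word : List OELetter) → All (λ e → isOdd e ≡ false) (evenParts v word)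
  evenParts-even v [] = []
  evenParts-even v ((m , _) ∷ word) = All.++⁺ (evenParts-even (suc v) word) (All.replicate⁺ m (isOdd-2* v))

  evenParts-sorted : (v : ℕ) (word : List OELetter) → AllPairs _≥_ (evenParts v word)
  evenParts-sorted v [] = []
  evenParts-sorted v ((m , _) ∷ word) =
    AllPairs.++⁺ (evenParts-sorted (suc v) word) (replicate-sorted m (2 * v))
      (All.map (λ 2v<e → All.replicate⁺ m (ℕ.<⇒≤ (ℕ.<-≤-trans (2*-mono-< (ℕ.n<1+n v)) 2v<e))) (evenParts-≥ (suc v) word))

  length-evenParts : (v : ℕ) (word : List OELetter) → length (evenParts v word) ≡ evenCount word
  length-evenParts v [] = refl
  length-evenParts v ((m , _) ∷ word) = begin
    length (evenParts (suc v) word ++ replicate m (2 * v))  ≡⟨ length-++ (evenParts (suc v) word) ⟩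
    length (evenParts (suc v) word) + length (replicate m (2 * v)) ≡⟨ cong₂ _+_ (length-evenParts (suc v) word) (length-replicate m) ⟩
    evenCount word + m ≡⟨ ℕ.+-comm (evenCount word) m ⟩
    m + evenCount word ∎
    where open ≡-Reasoning

  distinct-replicate : (m c M : ℕ) → All (_≤ M) (replicate m c) → count (λ x → elem x (replicate m c)) (range M) ≡ nonzero m
  distinct-replicate zero c M _ = count-none (λ x → elem x []) (All.universal (λ _ ()) (range M))
  distinct-replicate (suc m) c M (c≤M ∷ _) = trans (count-cong (range M) (elem-replicate m)) (count-≡ᵇ-range c≤M)
    where
    elem-replicate : ∀ m x → elem x (replicate (suc m) c) ≡ (c ≡ᵇ x)
    elem-replicate zero x = ∨-identityʳ (c ≡ᵇ x)
    elem-replicate (suc m) x = trans (cong ((c ≡ᵇ x) ∨_) (elem-replicate m x)) (∨-idem (c ≡ᵇ x))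

  distinct-evenParts : (v : ℕ) (word : List OELetter) (M : ℕ) → All (_≤ M) (evenParts v word) →
    count (λ x → elem x (evenParts v word)) (range M) ≡ OE.wordTags word
  distinct-evenParts v [] M _ = count-none (λ x → elem x []) (All.universal (λ _ ()) (range M))
  distinct-evenParts v ((m , b) ∷ word) M ≤M = begin
    count (λ x → elem x (rest ++ block)) (range M)
      ≡⟨ count-cong (range M) (λ x → elem-++ x rest block) ⟩
    count (λ x → elem x rest ∨ elem x block) (range M)
      ≡⟨ count-∨ (λ x → elem x rest) (λ x → elem x block) (range M) disjoint ⟩
    count (λ x → elem x rest) (range M) + count (λ x → elem x block) (range M)
      ≡⟨ cong₂ _+_ (distinct-evenParts (suc v) word M (All.++⁻ˡ rest ≤M)) (distinct-replicate m (2 * v) M (All.++⁻ʳ rest ≤M)) ⟩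
    OE.wordTags word + nonzero m
      ≡⟨ ℕ.+-comm (OE.wordTags word) (nonzero m) ⟩
    nonzero m + OE.wordTags word ∎
    where
    open ≡-Reasoning
    rest = evenParts (suc v) word
    block = replicate m (2 * v)
    disjoint : ∀ x → T (elem x rest) → ¬ T (elem x block)
    disjoint x x∈rest x∈block with All.lookup (All.replicate⁺ {P = _≡ 2 * v} m refl) (Equivalence.to T-elem x∈block)
    ... | refl = ℕ.<⇒≱ (2*-mono-< (ℕ.n<1+n v)) (All.lookup (evenParts-≥ (suc v) word) (Equivalence.to T-elem x∈rest))

  -- Stated for a suffix starting at position suc u: each of the u odd parts in front of it also
  -- contains the 2 · stepCount word contributed by the steps of the suffix.
  size-oddEvenParts : (u : ℕ) (word : List OELetter) →
    sum (oddParts word) + u * (2 * stepCount word) + sum (evenParts (suc u) word) ≡ suc (OE.wordSize (suc u) word)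
  size-oddEvenParts u [] = cong (λ t → suc (t + 0)) (ℕ.*-zeroʳ u)
  size-oddEvenParts u ((m , b) ∷ word) = begin
    suc (2 * S) + O + u * (2 * S) + sum (E ++ replicate m (2 * suc u))
      ≡⟨ cong (_+_ (suc (2 * S) + O + u * (2 * S)))
              (trans (sum-++ E (replicate m (2 * suc u))) (cong (_+_ (sum E)) (sum-replicate m (2 * suc u)))) ⟩
    suc (2 * S) + O + u * (2 * S) + (sum E + m * (2 * suc u))
      ≡⟨ regroup (bit b) (stepCount word) O u (sum E) m ⟩
    suc ((m + bit b) * (2 * suc u)) + (O + suc u * (2 * stepCount word) + sum E)
      ≡⟨ cong (_+_ (suc ((m + bit b) * (2 * suc u)))) (size-oddEvenParts (suc u) word) ⟩
    suc ((m + bit b) * (2 * suc u)) + suc (OE.wordSize (suc (suc u)) word)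
      ≡⟨ ℕ.+-suc (suc ((m + bit b) * (2 * suc u))) _ ⟩
    suc (OE.wordSize (suc u) ((m , b) ∷ word)) ∎
    where
    open ≡-Reasoning
    S = bit b + stepCount word
    O = sum (oddParts word)
    E = evenParts (suc (suc u)) word
    regroup : ∀ b s o u e m → suc (2 * (b + s)) + o + u * (2 * (b + s)) + (e + m * (2 * suc u)) ≡
                              suc ((m + b) * (2 * suc u)) + (o + suc u * (2 * s) + e)
    regroup = ℕ-Solver.solve-∀

  encodeOE : ℕ → List ℕ → List ℕ → List OELetter
  encodeOE v (o₁ ∷ o₂ ∷ os) es = (multiplicity (2 * v) es , not (o₁ ≡ᵇ o₂)) ∷ encodeOE (suc v) (o₂ ∷ os) es
  encodeOE v _ es = []

  Multiplicities : ℕ → List OELetter → List ℕ → Set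
  Multiplicities v [] es = ⊤
  Multiplicities v ((m , _) ∷ word) es = multiplicity (2 * v) es ≡ m × Multiplicities (suc v) word es

  encodeOE-oddParts : (v : ℕ) (word : List OELetter) (es : List ℕ) → Multiplicities v word es → encodeOE v (oddParts word) es ≡ word
  encodeOE-oddParts v [] es _ = refl
  encodeOE-oddParts v ((m , b) ∷ word) es (mult , mults) =
    cong₂ _∷_ (cong₂ _,_ mult (stepped b (stepCount word))) (encodeOE-oddParts (suc v) word es mults)
    where
    stepped : (b : Bool) (s : ℕ) → not (suc (2 * (bit b + s)) ≡ᵇ suc (2 * s)) ≡ b
    stepped false s = cong not (≡ᵇ-refl (2 * s))
    stepped true s = cong not (≢⇒≡ᵇ≡false (ℕ.<⇒≢ (2*-mono-< (ℕ.n<1+n s)) ∘ sym ∘ ℕ.suc-injective))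

  evenParts-missing : (v : ℕ) (word : List OELetter) → multiplicity (2 * v) (evenParts (suc v) word) ≡ 0
  evenParts-missing v word =
    multiplicity-absent _ (All.map (λ 2v<e → ℕ.<⇒≢ (ℕ.<-≤-trans (2*-mono-< (ℕ.n<1+n v)) 2v<e) ∘ sym) (evenParts-≥ (suc v) word))

  evenParts-multiplicities : (v : ℕ) (word : List OELetter) (X : List ℕ) → All (_< 2 * v) X →
    Multiplicities v word (evenParts v word ++ X)
  evenParts-multiplicities v [] X _ = _
  evenParts-multiplicities v ((m , _) ∷ word) X X<2v rewrite ++-assoc (evenParts (suc v) word) (replicate m (2 * v)) X =
    mult , evenParts-multiplicities (suc v) word (replicate m (2 * v) ++ X) block<
    where
    rest = evenParts (suc v) word
    mult : multiplicity (2 * v) (rest ++ replicate m (2 * v) ++ X) ≡ m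
    mult = begin
      multiplicity (2 * v) (rest ++ replicate m (2 * v) ++ X)
        ≡⟨ count-++ (_≡ᵇ 2 * v) rest _ ⟩
      multiplicity (2 * v) rest + multiplicity (2 * v) (replicate m (2 * v) ++ X)
        ≡⟨ cong₂ _+_ (evenParts-missing v word) (count-++ (_≡ᵇ 2 * v) (replicate m (2 * v)) X) ⟩
      0 + (multiplicity (2 * v) (replicate m (2 * v)) + multiplicity (2 * v) X)
        ≡⟨ cong₂ _+_ (multiplicity-replicate m (2 * v)) (multiplicity-absent X (All.map ℕ.<⇒≢ X<2v)) ⟩
      m + 0
        ≡⟨ ℕ.+-identityʳ m ⟩
      m ∎
      where open ≡-Reasoning
    block< : All (_< 2 * suc v) (replicate m (2 * v) ++ X)
    block< = All.++⁺ (All.replicate⁺ m (2*-mono-< (ℕ.n<1+n v))) (All.map (λ x<2v → ℕ.<-trans x<2v (2*-mono-< (ℕ.n<1+n v))) X<2v)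

  evenParts-multiplicity : (v : ℕ) (word : List OELetter) (es : List ℕ) →
    All (λ e → 2 * v ≤ e → e < 2 * (v + length word)) es → Multiplicities v word es →
    {u : ℕ} → v ≤ u → multiplicity (2 * u) (evenParts v word) ≡ multiplicity (2 * u) es
  evenParts-multiplicity v [] es bounded _ {u} v≤u =
    sym (multiplicity-absent es (All.map (λ { bound refl → ℕ.<⇒≱ (subst (λ t → 2 * u < 2 * t) (ℕ.+-identityʳ v) (bound 2v≤2u)) 2v≤2u })
                                         bounded))
    where 2v≤2u = ℕ.*-monoʳ-≤ 2 v≤u
  evenParts-multiplicity v ((m , _) ∷ word) es bounded (mult , mults) {u} v≤u with ℕ.m≤n⇒m<n∨m≡n v≤u
  ... | inj₂ refl = begin
    multiplicity (2 * v) (rest ++ replicate m (2 * v))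
      ≡⟨ count-++ (_≡ᵇ 2 * v) rest _ ⟩
    multiplicity (2 * v) rest + multiplicity (2 * v) (replicate m (2 * v))
      ≡⟨ cong₂ _+_ (evenParts-missing v word) (multiplicity-replicate m (2 * v)) ⟩
    m
      ≡⟨ mult ⟨
    multiplicity (2 * v) es ∎
    where
    open ≡-Reasoning
    rest = evenParts (suc v) word
  ... | inj₁ v<u = begin
    multiplicity (2 * u) (rest ++ replicate m (2 * v))
      ≡⟨ count-++ (_≡ᵇ 2 * u) rest _ ⟩
    multiplicity (2 * u) rest + multiplicity (2 * u) (replicate m (2 * v))
      ≡⟨ cong₂ _+_ (evenParts-multiplicity (suc v) word es (All.map shift bounded) mults v<u)
                   (multiplicity-absent (replicate m (2 * v)) (All.replicate⁺ m (ℕ.<⇒≢ (2*-mono-< v<u)))) ⟩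
    multiplicity (2 * u) es + 0
      ≡⟨ ℕ.+-identityʳ _ ⟩
    multiplicity (2 * u) es ∎
    where
    open ≡-Reasoning
    rest = evenParts (suc v) word
    shift : ∀ {e} → (2 * v ≤ e → e < 2 * (v + suc (length word))) → 2 * suc v ≤ e → e < 2 * (suc v + length word)
    shift {e} bound 2sv≤e = subst (λ t → e < 2 * t) (ℕ.+-suc v (length word)) (bound (ℕ.≤-trans (ℕ.*-monoʳ-≤ 2 (ℕ.n≤1+n v)) 2sv≤e))

  encodeOE-multiplicities : (v : ℕ) (os es : List ℕ) → Multiplicities v (encodeOE v os es) es
  encodeOE-multiplicities v [] es = _
  encodeOE-multiplicities v (o ∷ []) es = _
  encodeOE-multiplicities v (o₁ ∷ o₂ ∷ os) es = refl , encodeOE-multiplicities (suc v) (o₂ ∷ os) es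

  length-encodeOE : (v o : ℕ) (os es : List ℕ) → length (encodeOE v (o ∷ os) es) ≡ length os
  length-encodeOE v o [] es = refl
  length-encodeOE v o (o₂ ∷ os) es = cong suc (length-encodeOE (suc v) o₂ os es)

  data Staircase : List ℕ → Set where
    base : Staircase (1 ∷ [])
    flat : {o : ℕ} {os : List ℕ} → Staircase (o ∷ os) → Staircase (o ∷ o ∷ os)
    step : {o : ℕ} {os : List ℕ} → Staircase (o ∷ os) → Staircase (suc (suc o) ∷ o ∷ os)

  oddParts-encodeOE : {os : List ℕ} → Staircase os → (v : ℕ) (es : List ℕ) → oddParts (encodeOE v os es) ≡ os
  oddParts-encodeOE base v es = refl
  oddParts-encodeOE {o ∷ o ∷ os} (flat s) v es rewrite ≡ᵇ-refl o =
    cong₂ _∷_ (proj₁ (∷-injective ih)) ih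
    where ih = oddParts-encodeOE s (suc v) es
  oddParts-encodeOE {suc (suc o) ∷ o ∷ os} (step s) v es rewrite ≢⇒≡ᵇ≡false (ℕ.<⇒≢ (ℕ.<-trans (ℕ.n<1+n o) (ℕ.n<1+n (suc o))) ∘ sym) =
    cong₂ _∷_ (cong suc (trans (ℕ.*-suc 2 (stepCount word)) (cong suc (proj₁ (∷-injective ih))))) ih
    where
    word = encodeOE (suc v) (o ∷ os) es
    ih = oddParts-encodeOE s (suc v) es

  Gapless : ℕ → List ℕ → Set
  Gapless o os = ∀ {v} → T (isOdd v) → v < o → v ∈ o ∷ os

  gapless-tail : {o o′ : ℕ} {os : List ℕ} → o′ ≤ o → Gapless o (o′ ∷ os) → Gapless o′ os
  gapless-tail o′≤o gapless {v} odd-v v<o′ with gapless odd-v (ℕ.<-≤-trans v<o′ o′≤o)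
  ... | here refl = ⊥-elim (ℕ.<-irrefl refl (ℕ.<-≤-trans v<o′ o′≤o))
  ... | there v∈ = v∈

  no-odd-skipped : {o o′ : ℕ} {os : List ℕ} → T (isOdd o′) → Linked _≥_ (o′ ∷ os) → Gapless o (o′ ∷ os) → ¬ suc (suc o′) < o
  no-odd-skipped {o} {o′} odd-o′ sorted gapless o′+2<o with gapless odd-o′ o′+2<o
  ... | here refl = ℕ.<-irrefl refl o′+2<o
  ... | there o′+2∈ = ℕ.<⇒≱ (ℕ.<-trans (ℕ.n<1+n o′) (ℕ.n<1+n (suc o′))) (All.lookup (Linked⇒All ≥-trans ℕ.≤-refl sorted) o′+2∈)

  staircase : {o : ℕ} {os : List ℕ} → All (T ∘ isOdd) (o ∷ os) → Linked _≥_ (o ∷ os) → Gapless o os → Staircase (o ∷ os)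
  staircase {zero} (() ∷ _) _ _
  staircase {suc zero} {[]} _ _ _ = base
  staircase {suc (suc o)} {[]} _ _ gapless with gapless {1} _ (s≤s (s≤s z≤n))
  ... | here ()
  ... | there ()
  staircase {o} {o′ ∷ os} (odd-o ∷ odds@(odd-o′ ∷ _)) (o′≤o ∷ sorted) gapless
    with odd-successor odd-o′ odd-o o′≤o (ℕ.≮⇒≥ (no-odd-skipped odd-o′ sorted gapless))
  ... | inj₁ refl = flat (staircase odds sorted (gapless-tail o′≤o gapless))
  ... | inj₂ refl = step (staircase odds sorted (gapless-tail o′≤o gapless))

  decodeOE : List OELetter → List ℕ × List ℕ
  decodeOE word = oddParts word , evenParts 1 word

  encodeOE₁ : List ℕ × List ℕ → List OELetter
  encodeOE₁ (os , es) = encodeOE 1 os es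

  -- The odd parts come back because they form a staircase, the even parts because a sorted list
  -- is determined by its multiplicities.
  decode-encodeOE : {k : ℕ} {os es : List ℕ} → 1 ≤ k → OddParts k os → EvenParts k (length os) es →
    decodeOE (encodeOE₁ (os , es)) ≡ (os , es)
  decode-encodeOE {k} {[]} 1≤k odds _ = ⊥-elim (ℕ.<⇒≱ (ℕ.<-≤-trans (s≤s z≤n) 1≤k) (OddParts.enough odds))
  decode-encodeOE {k} {o ∷ os} {es} 1≤k odds evens = cong₂ _,_ (oddParts-encodeOE stairs 1 es) evensEq
    where
    open OddParts odds renaming (sorted to oSorted)
    open EvenParts evens
    stairs : Staircase (o ∷ os)
    stairs = staircase odd oSorted (λ odd-v v<o → gapless odd-v (subst (_ <_) (sym (maxL-sorted oSorted)) v<o))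
    word = encodeOE 1 (o ∷ os) es
    evensEq : evenParts 1 word ≡ es
    evensEq = sorted-by-multiplicities (evenParts-sorted 1 word) (Linked⇒AllPairs ≥-trans sorted) sameMult
      where
      sameMult : ∀ c → multiplicity c (evenParts 1 word) ≡ multiplicity c es
      sameMult c with isOdd c in odd-c
      ... | true = trans (noOdd (evenParts-even 1 word)) (sym (noOdd even))
        where
        noOdd : ∀ {xs} → All (λ e → isOdd e ≡ false) xs → multiplicity c xs ≡ 0
        noOdd evenAll = multiplicity-absent _ (All.map (λ { e-even refl → case trans (sym odd-c) e-even of λ () }) evenAll)
      ... | false with even-half c odd-c
      ...   | zero , refl = trans (multiplicity-absent _ (All.map (λ { 2≤e refl → case 2≤e of λ () }) (evenParts-≥ 1 word)))
                                  (sym (multiplicity-absent es (All.map (λ { 1≤e refl → case 1≤e of λ () }) positive)))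
      ...   | suc u , refl = evenParts-multiplicity 1 word es (All.map bound small) (encodeOE-multiplicities 1 (o ∷ os) es) (s≤s z≤n)
        where
        bound : ∀ {e} → e < 2 * suc (length os) → 2 ≤ e → e < 2 * (1 + length word)
        bound {e} e< _ = subst (λ t → e < 2 * suc t) (sym (length-encodeOE 1 o os es)) e<

  oe-wordTags≤length : (word : List OELetter) → OE.wordTags word ≤ length word
  oe-wordTags≤length [] = z≤n
  oe-wordTags≤length ((zero , _) ∷ word) = ℕ.m≤n⇒m≤1+n (oe-wordTags≤length word)
  oe-wordTags≤length ((suc _ , _) ∷ word) = s≤s (oe-wordTags≤length word)

  distinctCount-decodeOE : (word : List OELetter) → distinctCount (evenParts 1 word) ≡ OE.wordTags word
  distinctCount-decodeOE word = distinct-evenParts 1 word _ (maxL-upper (evenParts 1 word))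

  size-decodeOE : (word : List OELetter) → sum (oddParts word) + sum (evenParts 1 word) ≡ suc (OE.wordSize 1 word)
  size-decodeOE word = trans (cong (_+ sum (evenParts 1 word)) (sym (ℕ.+-identityʳ (sum (oddParts word))))) (size-oddEvenParts 0 word)

  encode-decodeOE : (word : List OELetter) → encodeOE₁ (decodeOE word) ≡ word
  encode-decodeOE word = encodeOE-oddParts 1 word (evenParts 1 word)
    (subst (Multiplicities 1 word) (++-identityʳ (evenParts 1 word)) (evenParts-multiplicities 1 word [] []))

  ∈-oeLetters : {m n : ℕ} (b : Bool) → m ≤ n → (m , b) ∈ oeLetters n
  ∈-oeLetters false m≤n = ∈-cartesianProduct⁺ (∈-range⁺ m≤n) (here refl)
  ∈-oeLetters true m≤n = ∈-cartesianProduct⁺ (∈-range⁺ m≤n) (there (here refl))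

  encodeOE-letters : (v : ℕ) (os es : List ℕ) → All (λ x → proj₁ x ≤ length es) (encodeOE v os es)
  encodeOE-letters v [] es = []
  encodeOE-letters v (o ∷ []) es = []
  encodeOE-letters v (o₁ ∷ o₂ ∷ os) es = count≤length _ es ∷ encodeOE-letters (suc v) (o₂ ∷ os) es

  encodeOE-∈ : {k n : ℕ} {os es : List ℕ} → 1 ≤ k → OddParts k os → All (1 ≤_) es → sum os + sum es ≡ n →
    encodeOE₁ (os , es) ∈ listsUpTo n (oeLetters n)
  encodeOE-∈ {os = []} 1≤k odds _ _ = ⊥-elim (ℕ.<⇒≱ (ℕ.<-≤-trans (s≤s z≤n) 1≤k) (OddParts.enough odds))
  encodeOE-∈ {n = n} {o ∷ os} {es} _ odds positive size =
    ∈-listsUpTo⁺ (subst (_≤ n) (sym (length-encodeOE 1 o os es)) (ℕ.≤-trans (ℕ.n≤1+n _) osLength≤n))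
      (All.map (λ {x} m≤ → ∈-oeLetters (proj₂ x) (ℕ.≤-trans m≤ esLength≤n)) (encodeOE-letters 1 (o ∷ os) es))
    where
    osLength≤n = ℕ.≤-trans (length≤sum (o ∷ os) (odds-positive (OddParts.odd odds))) (ℕ.≤-trans (ℕ.m≤m+n _ _) (ℕ.≤-reflexive size))
    esLength≤n = ℕ.≤-trans (length≤sum es positive) (ℕ.≤-trans (ℕ.m≤n+m _ _) (ℕ.≤-reflexive size))

  oeLetters-unique : (n : ℕ) → Unique (oeLetters n)
  oeLetters-unique n = Unique.cartesianProduct⁺ (range-unique n) (((λ ()) ∷ []) ∷ [] ∷ [])

  module _ (par : Bool) (k n : ℕ) where

    oeCondition : List OELetter → Bool
    oeCondition word = ((OE.wordTags word ≡ᵇ k ∸ 1) ∧ (suc (OE.wordSize 1 word) ≡ᵇ n)) ∧ parityIs par (evenCount word)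

    decodeOE-valid : (word : List OELetter) → T (oeCondition word) → OmegaEpsObject par k n (oddParts word) (evenParts 1 word)
    decodeOE-valid word cond = record
      { odds = record
        { odd = oddParts-odd word
        ; sorted = oddParts-sorted word
        ; enough = subst (k ≤_) (sym (length-oddParts word))
                     (ℕ.≤-trans (ℕ.m≤n+m∸n k 1) (s≤s (subst (_≤ length word) tags (oe-wordTags≤length word))))
        ; gapless = λ {v} odd-v v<max → oddParts-gapless word odd-v (subst (v <_) (maxL-sorted (oddParts-sorted word)) v<max)
        }
      ; evens = record
        { positive = All.map (ℕ.≤-trans (s≤s z≤n)) (evenParts-≥ 1 word)
        ; even = evenParts-even 1 word
        ; sorted = AllPairs⇒Linked (evenParts-sorted 1 word)
        ; distinct = trans (distinctCount-decodeOE word) tags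
        ; small = All.map (λ {e} e< → subst (λ t → e < 2 * t) (sym (length-oddParts word)) e<) (evenParts-< 1 word)
        }
      ; parity = trans (cong isOdd (length-evenParts 1 word)) (Equivalence.to (parityIs-≡ par (evenCount word)) parity)
      ; size = trans (size-decodeOE word) size
      }
      where
      conds = T-∧⁻ cond
      tags = ℕ.≡ᵇ⇒≡ _ _ (proj₁ (T-∧⁻ (proj₁ conds)))
      size = ℕ.≡ᵇ⇒≡ _ _ (proj₂ (T-∧⁻ (proj₁ conds)))
      parity = proj₂ conds

    encodeOE-valid : {os es : List ℕ} → 1 ≤ k → OmegaEpsObject par k n os es → T (oeCondition (encodeOE₁ (os , es)))
    encodeOE-valid {os} {es} 1≤k object =
      T-∧⁺ (T-∧⁺ (ℕ.≡⇒≡ᵇ _ _ tags) (ℕ.≡⇒≡ᵇ _ _ size)) (Equivalence.from (parityIs-≡ par _) parity)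
      where
      open OmegaEpsObject object renaming (parity to esParity; size to esSize)
      word = encodeOE₁ (os , es)
      decoded = decode-encodeOE 1≤k odds evens
      oddsEq = cong proj₁ decoded
      evensEq = cong proj₂ decoded
      tags : OE.wordTags word ≡ k ∸ 1
      tags = trans (sym (distinctCount-decodeOE word)) (trans (cong distinctCount evensEq) (EvenParts.distinct evens))
      size : suc (OE.wordSize 1 word) ≡ n
      size = trans (sym (size-decodeOE word)) (trans (cong₂ (λ os es → sum os + sum es) oddsEq evensEq) esSize)
      parity : isOdd (evenCount word) ≡ par
      parity = trans (cong isOdd (trans (sym (length-evenParts 1 word)) (cong length evensEq))) esParity

    omegaEps-count : 1 ≤ k → count (isOmegaEps par k n) (oeCandidates n) ≡ count oeCondition (listsUpTo n (oeLetters n))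
    omegaEps-count 1≤k = count-bijection encodeOE₁ decodeOE
      (Unique.cartesianProduct⁺ (listsUpTo-unique n (range-unique n)) (listsUpTo-unique n (range-unique n)))
      (listsUpTo-unique n (oeLetters-unique n))
      forth back
      where
      forth : ∀ {x} → x ∈ oeCandidates n → T (isOmegaEps par k n x) →
              encodeOE₁ x ∈ listsUpTo n (oeLetters n) × T (oeCondition (encodeOE₁ x)) × decodeOE (encodeOE₁ x) ≡ x
      forth {os , es} _ valid = member , encodeOE-valid 1≤k object , decode-encodeOE 1≤k odds evens
        where
        object = Equivalence.to T-isOmegaEps valid
        open OmegaEpsObject object
        member = encodeOE-∈ 1≤k odds (EvenParts.positive evens) size
      back : ∀ {word} → word ∈ listsUpTo n (oeLetters n) → T (oeCondition word) →
             decodeOE word ∈ oeCandidates n × T (isOmegaEps par k n (decodeOE word)) × encodeOE₁ (decodeOE word) ≡ word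
      back {word} _ cond = member , Equivalence.from T-isOmegaEps object , encode-decodeOE word
        where
        object = decodeOE-valid word cond
        open OmegaEpsObject object
        member : decodeOE word ∈ oeCandidates n
        member = ∈-cartesianProduct⁺
          (∈-listsUpTo-range _ (odds-positive (oddParts-odd word)) (ℕ.≤-trans (ℕ.m≤m+n _ _) (ℕ.≤-reflexive size)))
          (∈-listsUpTo-range _ (EvenParts.positive evens) (ℕ.≤-trans (ℕ.m≤n+m _ _) (ℕ.≤-reflexive size)))

  -- Self-conjugate symbols as words

  -- The cells are listed from the largest value down; a part's mark is one more than the number
  -- of present-max cells below it.
  rowOf : List Cell → Row
  rowOf [] = []
  rowOf (absent ∷ cs) = rowOf cs
  rowOf (present ∷ cs) = (suc (length cs) , suc (SC.wordTags cs)) ∷ rowOf cs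
  rowOf (present-max ∷ cs) = (suc (length cs) , suc (SC.wordTags cs)) ∷ rowOf cs

  rowOf-present : {c : Cell} {cs : List Cell} → c ≡ present ⊎ c ≡ present-max →
    rowOf (c ∷ cs) ≡ (suc (length cs) , suc (SC.wordTags cs)) ∷ rowOf cs
  rowOf-present (inj₁ refl) = refl
  rowOf-present (inj₂ refl) = refl

  PartsIn : ℕ → Row → Set
  PartsIn L = All (λ x → 1 ≤ proj₁ x × proj₁ x ≤ L)

  PartsDecreasing : Row → Set
  PartsDecreasing = AllPairs (_>_ on proj₁)

  MarksNonincreasing : Row → Set
  MarksNonincreasing = AllPairs (_≥_ on proj₂)

  rowOf-parts : (cs : List Cell) → PartsIn (length cs) (rowOf cs)
  rowOf-parts [] = []
  rowOf-parts (absent ∷ cs) = All.map (λ (p , q) → p , ℕ.m≤n⇒m≤1+n q) (rowOf-parts cs)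
  rowOf-parts (present ∷ cs) = (s≤s z≤n , ℕ.≤-refl) ∷ All.map (λ (p , q) → p , ℕ.m≤n⇒m≤1+n q) (rowOf-parts cs)
  rowOf-parts (present-max ∷ cs) = (s≤s z≤n , ℕ.≤-refl) ∷ All.map (λ (p , q) → p , ℕ.m≤n⇒m≤1+n q) (rowOf-parts cs)

  rowOf-decreasing : (cs : List Cell) → PartsDecreasing (rowOf cs)
  rowOf-decreasing [] = []
  rowOf-decreasing (absent ∷ cs) = rowOf-decreasing cs
  rowOf-decreasing (present ∷ cs) = All.map (s≤s ∘ proj₂) (rowOf-parts cs) ∷ rowOf-decreasing cs
  rowOf-decreasing (present-max ∷ cs) = All.map (s≤s ∘ proj₂) (rowOf-parts cs) ∷ rowOf-decreasing cs

  rowOf-marks : (cs : List Cell) → All (λ x → 1 ≤ proj₂ x × proj₂ x ≤ suc (SC.wordTags cs)) (rowOf cs)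
  rowOf-marks [] = []
  rowOf-marks (absent ∷ cs) = rowOf-marks cs
  rowOf-marks (present ∷ cs) = (s≤s z≤n , ℕ.≤-refl) ∷ rowOf-marks cs
  rowOf-marks (present-max ∷ cs) = (s≤s z≤n , ℕ.n≤1+n _) ∷ All.map (λ (p , q) → p , ℕ.m≤n⇒m≤1+n q) (rowOf-marks cs)

  rowOf-nonincreasing : (cs : List Cell) → MarksNonincreasing (rowOf cs)
  rowOf-nonincreasing [] = []
  rowOf-nonincreasing (absent ∷ cs) = rowOf-nonincreasing cs
  rowOf-nonincreasing (present ∷ cs) = All.map proj₂ (rowOf-marks cs) ∷ rowOf-nonincreasing cs
  rowOf-nonincreasing (present-max ∷ cs) = All.map proj₂ (rowOf-marks cs) ∷ rowOf-nonincreasing cs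

  rowOf-cover : (cs : List Cell) {j : ℕ} → 1 ≤ j → j ≤ SC.wordTags cs → j ∈ marks (rowOf cs)
  rowOf-cover [] (s≤s _) ()
  rowOf-cover (absent ∷ cs) 1≤j j≤ = rowOf-cover cs 1≤j j≤
  rowOf-cover (present ∷ cs) 1≤j j≤ = there (rowOf-cover cs 1≤j j≤)
  rowOf-cover (present-max ∷ cs) 1≤j j≤ with ℕ.m≤n⇒m<n∨m≡n j≤
  ... | inj₁ (s≤s j≤′) = there (rowOf-cover cs 1≤j j≤′)
  ... | inj₂ refl = here refl

  rowOf-∷-sum : (c : Cell) (cs : List Cell) → sum (parts (rowOf (c ∷ cs))) ≡ cellWeight c * suc (length cs) + sum (parts (rowOf cs))
  rowOf-∷-sum absent cs = refl
  rowOf-∷-sum present cs = cong (_+ sum (parts (rowOf cs))) (sym (ℕ.+-identityʳ (suc (length cs))))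
  rowOf-∷-sum present-max cs = cong (_+ sum (parts (rowOf cs))) (sym (ℕ.+-identityʳ (suc (length cs))))

  sc-wordSize-reverse : (cs : List Cell) → SC.wordSize 1 (reverse cs) ≡ length cs + 2 * sum (parts (rowOf cs))
  sc-wordSize-reverse [] = refl
  sc-wordSize-reverse (c ∷ cs) = begin
    SC.wordSize 1 (reverse (c ∷ cs))
      ≡⟨ cong (SC.wordSize 1) (unfold-reverse c cs) ⟩
    SC.wordSize 1 (reverse cs ++ c ∷ [])
      ≡⟨ SC.wordSize-++ 1 (reverse cs) (c ∷ []) ⟩
    SC.wordSize 1 (reverse cs) + (cellSize (suc (length (reverse cs))) c + 0)
      ≡⟨ cong₂ (λ a l → a + (cellSize (suc l) c + 0)) (sc-wordSize-reverse cs) (length-reverse cs) ⟩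
    length cs + 2 * S + (suc (cellWeight c * (2 * suc (length cs))) + 0)
      ≡⟨ regroup (length cs) S (cellWeight c) ⟩
    suc (length cs) + 2 * (cellWeight c * suc (length cs) + S)
      ≡⟨ cong (λ t → suc (length cs) + 2 * t) (rowOf-∷-sum c cs) ⟨
    suc (length cs) + 2 * sum (parts (rowOf (c ∷ cs))) ∎
    where
    open ≡-Reasoning
    S = sum (parts (rowOf cs))
    regroup : ∀ l s w → l + 2 * s + (suc (w * (2 * suc l)) + 0) ≡ suc l + 2 * (w * suc l + s)
    regroup = ℕ-Solver.solve-∀

  symbolSize-decodeSymbol : (word : List Cell) →
    symbolSize (suc (length word)) (rowOf (reverse word)) (rowOf (reverse word)) ≡ suc (SC.wordSize 1 word)
  symbolSize-decodeSymbol word = begin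
    suc (length word) + S + S
      ≡⟨ regroup (length word) S ⟩
    suc (length word + 2 * S)
      ≡⟨ cong (λ l → suc (l + 2 * S)) (length-reverse word) ⟨
    suc (length (reverse word) + 2 * S)
      ≡⟨ cong suc (sc-wordSize-reverse (reverse word)) ⟨
    suc (SC.wordSize 1 (reverse (reverse word)))
      ≡⟨ cong (suc ∘ SC.wordSize 1) (reverse-involutive word) ⟩
    suc (SC.wordSize 1 word) ∎
    where
    open ≡-Reasoning
    S = sum (parts (rowOf (reverse word)))
    regroup : ∀ l s → suc l + s + s ≡ suc (l + 2 * s)
    regroup = ℕ-Solver.solve-∀

  sc-wordTags-reverse : (cs : List Cell) → SC.wordTags (reverse cs) ≡ SC.wordTags cs
  sc-wordTags-reverse [] = refl
  sc-wordTags-reverse (c ∷ cs) = begin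
    SC.wordTags (reverse (c ∷ cs))          ≡⟨ cong SC.wordTags (unfold-reverse c cs) ⟩
    SC.wordTags (reverse cs ++ c ∷ [])      ≡⟨ SC.wordTags-++ (reverse cs) (c ∷ []) ⟩
    SC.wordTags (reverse cs) + (cellTag c + 0) ≡⟨ cong₂ _+_ (sc-wordTags-reverse cs) (ℕ.+-identityʳ (cellTag c)) ⟩
    SC.wordTags cs + cellTag c              ≡⟨ ℕ.+-comm (SC.wordTags cs) (cellTag c) ⟩
    cellTag c + SC.wordTags cs              ∎
    where open ≡-Reasoning

  MarksDescend : ℕ → Row → Set
  MarksDescend q [] = q ≡ 1
  MarksDescend q ((_ , j) ∷ row) = (j ≡ q ⊎ suc j ≡ q) × 1 ≤ j × MarksDescend j row

  partsIn-0 : {row : Row} → PartsIn 0 row → row ≡ []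
  partsIn-0 [] = refl
  partsIn-0 ((1≤a , a≤0) ∷ _) = ⊥-elim (ℕ.<⇒≱ 1≤a a≤0)

  partsIn-skip : {L a j : ℕ} {row : Row} → PartsDecreasing ((a , j) ∷ row) → a ≢ suc L →
    PartsIn (suc L) ((a , j) ∷ row) → PartsIn L ((a , j) ∷ row)
  partsIn-skip {L} {a} (a> ∷ _) a≢ ((1≤a , a≤) ∷ bounds) =
    (1≤a , a≤L) ∷ All.zipWith (λ (y<a , (1≤y , _)) → 1≤y , ℕ.≤-trans (ℕ.<⇒≤ y<a) a≤L) (a> , bounds)
    where a≤L = ℕ.≤-pred (ℕ.≤∧≢⇒< a≤ a≢)

  partsIn-take : {L j : ℕ} {row : Row} → PartsDecreasing ((suc L , j) ∷ row) → PartsIn (suc L) ((suc L , j) ∷ row) → PartsIn L row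
  partsIn-take (a> ∷ _) (_ ∷ bounds) = All.zipWith (λ (y<a , (1≤y , _)) → 1≤y , ℕ.≤-pred y<a) (a> , bounds)

  module _ (k : ℕ) where

    -- `encodeRow L p row` lists the cells of L, L − 1, …, 1, where p is the mark of the previous
    -- (larger) part, or 0 before the first one.
    cellFor : ℕ → ℕ → Cell
    cellFor p j = if (j <ᵇ k) ∧ not (p ≡ᵇ j) then present-max else present

    encodeRow : ℕ → ℕ → Row → List Cell
    encodeRow zero p row = []
    encodeRow (suc L) p [] = absent ∷ encodeRow L p []
    encodeRow (suc L) p ((a , j) ∷ row) =
      if a ≡ᵇ suc L then cellFor p j ∷ encodeRow L j row else absent ∷ encodeRow L p ((a , j) ∷ row)

    length-encodeRow : (L p : ℕ) (row : Row) → length (encodeRow L p row) ≡ L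
    length-encodeRow zero p row = refl
    length-encodeRow (suc L) p [] = cong suc (length-encodeRow L p [])
    length-encodeRow (suc L) p ((a , j) ∷ row) with a ≡ᵇ suc L
    ... | true = cong suc (length-encodeRow L j row)
    ... | false = cong suc (length-encodeRow L p ((a , j) ∷ row))

    PreviousMark : ℕ → List Cell → Set
    PreviousMark p cs = (p ≡ suc (SC.wordTags cs) ⊎ (p ≡ 0 × SC.wordTags cs ≡ k ∸ 1)) × SC.wordTags cs ≤ k ∸ 1

    encodeRow-rowOf : 1 ≤ k → (cs : List Cell) (p : ℕ) → PreviousMark p cs → encodeRow (length cs) p (rowOf cs) ≡ cs
    encodeRow-rowOf 1≤k [] p _ = refl
    encodeRow-rowOf 1≤k (absent ∷ cs) p prev = trans (skip (rowOf cs) (rowOf-parts cs)) (cong (absent ∷_) (encodeRow-rowOf 1≤k cs p prev))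
      where
      skip : (row : Row) → PartsIn (length cs) row → encodeRow (suc (length cs)) p row ≡ absent ∷ encodeRow (length cs) p row
      skip [] _ = refl
      skip ((a , j) ∷ row) ((_ , a≤) ∷ _) rewrite ≢⇒≡ᵇ≡false (ℕ.<⇒≢ (s≤s a≤)) = refl
    encodeRow-rowOf 1≤k (present ∷ cs) p (prev , tags≤) rewrite ≡ᵇ-refl (length cs) =
      cong₂ _∷_ (plain p prev) (encodeRow-rowOf 1≤k cs (suc (SC.wordTags cs)) (inj₁ refl , tags≤))
      where
      plain : ∀ p → p ≡ suc (SC.wordTags cs) ⊎ (p ≡ 0 × SC.wordTags cs ≡ k ∸ 1) → cellFor p (suc (SC.wordTags cs)) ≡ present
      plain p (inj₁ refl) rewrite ≡ᵇ-refl (SC.wordTags cs) with suc (SC.wordTags cs) <ᵇ k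
      ... | true = refl
      ... | false = refl
      plain p (inj₂ (refl , tags≡)) rewrite ≤⇒<ᵇ≡false (subst (λ t → k ≤ suc t) (sym tags≡) (ℕ.m≤n+m∸n k 1)) = refl
    encodeRow-rowOf 1≤k (present-max ∷ cs) p (prev , tags<) rewrite ≡ᵇ-refl (length cs) =
      cong₂ _∷_ (maximal p prev) (encodeRow-rowOf 1≤k cs (suc (SC.wordTags cs)) (inj₁ refl , ℕ.<⇒≤ tags<))
      where
      maximal : ∀ p → p ≡ suc (suc (SC.wordTags cs)) ⊎ (p ≡ 0 × suc (SC.wordTags cs) ≡ k ∸ 1) →
                cellFor p (suc (SC.wordTags cs)) ≡ present-max
      maximal p prev rewrite <⇒<ᵇ≡true (ℕ.≤-trans (s≤s tags<) (ℕ.≤-reflexive (ℕ.m+[n∸m]≡n 1≤k))) with prev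
      ... | inj₁ refl rewrite ≢⇒≡ᵇ≡false (ℕ.<⇒≢ (ℕ.n<1+n (suc (SC.wordTags cs))) ∘ sym) = refl
      ... | inj₂ (refl , _) = refl

    encodeRow-skip : {L a p j : ℕ} (row : Row) → a ≢ suc L → encodeRow (suc L) p ((a , j) ∷ row) ≡ absent ∷ encodeRow L p ((a , j) ∷ row)
    encodeRow-skip row a≢ rewrite ≢⇒≡ᵇ≡false a≢ = refl

    encodeRow-take : {L p j : ℕ} (row : Row) → encodeRow (suc L) p ((suc L , j) ∷ row) ≡ cellFor p j ∷ encodeRow L j row
    encodeRow-take {L} row rewrite ≡ᵇ-refl L = refl

    cellFor-cases : (p j : ℕ) → cellFor p j ≡ present ⊎ cellFor p j ≡ present-max
    cellFor-cases p j with (j <ᵇ k) ∧ not (p ≡ᵇ j)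
    ... | true = inj₂ refl
    ... | false = inj₁ refl

    tags-cellFor : {p j q : ℕ} → 1 ≤ j → q ≤ k → (j ≡ q ⊎ suc j ≡ q) → (p ≡ q ⊎ (p ≡ 0 × q ≡ k)) →
      cellTag (cellFor p j) + (j ∸ 1) ≡ q ∸ 1
    tags-cellFor {p} {j} _ _ (inj₁ refl) (inj₁ refl) rewrite ≡ᵇ-refl j with j <ᵇ k
    ... | true = refl
    ... | false = refl
    tags-cellFor {p} {j} _ _ (inj₁ refl) (inj₂ (refl , refl)) rewrite ≤⇒<ᵇ≡false (ℕ.≤-refl {j}) = refl
    tags-cellFor {_} {suc j} _ q≤k (inj₂ refl) (inj₁ refl)
      rewrite <⇒<ᵇ≡true q≤k | ≢⇒≡ᵇ≡false (ℕ.<⇒≢ (ℕ.n<1+n (suc j)) ∘ sym) = refl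
    tags-cellFor {_} {suc j} _ q≤k (inj₂ refl) (inj₂ (refl , _)) rewrite <⇒<ᵇ≡true q≤k = refl

    tags-encodeRow : (L p q : ℕ) (row : Row) → 1 ≤ q → q ≤ k → (p ≡ q ⊎ (p ≡ 0 × q ≡ k)) →
      PartsDecreasing row → PartsIn L row → MarksDescend q row → SC.wordTags (encodeRow L p row) ≡ q ∸ 1
    tags-encodeRow zero p q row _ _ _ _ bounds descend with partsIn-0 bounds
    tags-encodeRow zero p q [] _ _ _ _ _ refl | refl = refl
    tags-encodeRow (suc L) p q [] 1≤q q≤k previous dec _ descend = tags-encodeRow L p q [] 1≤q q≤k previous dec [] descend
    tags-encodeRow (suc L) p q ((a , j) ∷ row) 1≤q q≤k previous dec@(_ ∷ decTail) bounds descend with a ℕ.≟ suc L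
    ... | no a≢ = trans (cong SC.wordTags (encodeRow-skip row a≢))
                        (tags-encodeRow L p q ((a , j) ∷ row) 1≤q q≤k previous dec (partsIn-skip dec a≢ bounds) descend)
    ... | yes refl with descend
    ...   | j~q , 1≤j , descend′ = begin
      SC.wordTags (encodeRow (suc L) p ((suc L , j) ∷ row))
        ≡⟨ cong SC.wordTags (encodeRow-take {L} {p} row) ⟩
      cellTag (cellFor p j) + SC.wordTags (encodeRow L j row)
        ≡⟨ cong (_+_ (cellTag (cellFor p j)))
                (tags-encodeRow L j j row 1≤j (ℕ.≤-trans (j≤q j~q) q≤k) (inj₁ refl) decTail (partsIn-take dec bounds) descend′) ⟩
      cellTag (cellFor p j) + (j ∸ 1)
        ≡⟨ tags-cellFor 1≤j q≤k j~q previous ⟩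
      q ∸ 1 ∎
      where
      open ≡-Reasoning
      j≤q : j ≡ q ⊎ suc j ≡ q → j ≤ q
      j≤q (inj₁ refl) = ℕ.≤-refl
      j≤q (inj₂ refl) = ℕ.n≤1+n j

    rowOf-encodeRow : (L p q : ℕ) (row : Row) → PartsDecreasing row → PartsIn L row → MarksDescend q row →
      All (λ x → proj₂ x ≤ k) row → rowOf (encodeRow L p row) ≡ row
    rowOf-encodeRow zero p q row _ bounds _ _ = sym (partsIn-0 bounds)
    rowOf-encodeRow (suc L) p q [] dec _ descend _ = rowOf-encodeRow L p q [] dec [] descend []
    rowOf-encodeRow (suc L) p q ((a , j) ∷ row) dec@(_ ∷ decTail) bounds descend marks≤k@(j≤k ∷ rest≤k) with a ℕ.≟ suc L
    ... | no a≢ = trans (cong rowOf (encodeRow-skip row a≢))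
                        (rowOf-encodeRow L p q ((a , j) ∷ row) dec (partsIn-skip dec a≢ bounds) descend marks≤k)
    ... | yes refl with descend
    ...   | _ , 1≤j , descend′ = begin
      rowOf (encodeRow (suc L) p ((suc L , j) ∷ row))
        ≡⟨ cong rowOf (encodeRow-take {L} {p} row) ⟩
      rowOf (cellFor p j ∷ rest)
        ≡⟨ rowOf-present (cellFor-cases p j) ⟩
      (suc (length rest) , suc (SC.wordTags rest)) ∷ rowOf rest
        ≡⟨ cong₂ (λ l t → (suc l , suc t) ∷ rowOf rest)
                 (length-encodeRow L j row) (tags-encodeRow L j j row 1≤j j≤k (inj₁ refl) decTail tailBounds descend′) ⟩
      (suc L , suc (j ∸ 1)) ∷ rowOf rest
        ≡⟨ cong₂ (λ m r → (suc L , m) ∷ r) (ℕ.m+[n∸m]≡n 1≤j) (rowOf-encodeRow L j j row decTail tailBounds descend′ rest≤k) ⟩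
      (suc L , j) ∷ row ∎
      where
      open ≡-Reasoning
      rest = encodeRow L j row
      tailBounds = partsIn-take dec bounds

  smaller-mark⇒smaller-part : {row : Row} → PartsDecreasing row → MarksNonincreasing row →
    {x y : ℕ × ℕ} → x ∈ row → y ∈ row → proj₂ y < proj₂ x → proj₁ y < proj₁ x
  smaller-mark⇒smaller-part _ _ (here refl) (here refl) y<x = ⊥-elim (ℕ.<-irrefl refl y<x)
  smaller-mark⇒smaller-part (x> ∷ _) _ (here refl) (there y∈) _ = All.lookup x> y∈
  smaller-mark⇒smaller-part _ (y≤ ∷ _) (there x∈) (here refl) y<x = ⊥-elim (ℕ.<⇒≱ y<x (All.lookup y≤ x∈))
  smaller-mark⇒smaller-part (_ ∷ dec) (_ ∷ noninc) (there x∈) (there y∈) y<x = smaller-mark⇒smaller-part dec noninc x∈ y∈ y<x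

  largestWithMark-≥ : {a j : ℕ} (row : Row) → (a , j) ∈ row → a ≤ largestWithMark j row
  largestWithMark-≥ {a} {j} ((_ , m) ∷ row) (here refl) rewrite ≡ᵇ-refl j = ℕ.m≤m⊔n a _
  largestWithMark-≥ {a} {j} ((a′ , m) ∷ row) (there a∈) with m ≡ᵇ j
  ... | true = ℕ.≤-trans (largestWithMark-≥ row a∈) (ℕ.m≤n⊔m a′ _)
  ... | false = largestWithMark-≥ row a∈

  largestWithMark-< : {a j : ℕ} (row : Row) → 0 < a → All (λ y → proj₂ y ≡ j → proj₁ y < a) row → largestWithMark j row < a
  largestWithMark-< [] 0<a [] = 0<a
  largestWithMark-< {a} {j} ((a′ , m) ∷ row) 0<a (below ∷ rest) with m ≡ᵇ j in m≡j
  ... | true = ℕ.⊔-lub (below (ℕ.≡ᵇ⇒≡ m j (subst T (sym m≡j) _))) (largestWithMark-< row 0<a rest)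
  ... | false = largestWithMark-< row 0<a rest

  bottomPartOK-self : (k P : ℕ) (row : Row) → PartsDecreasing row → MarksNonincreasing row →
    All (λ x → 1 ≤ proj₁ x × proj₁ x < P) row → All (λ x → 1 ≤ proj₂ x × proj₂ x ≤ k) row → All (T ∘ bottomPartOK k P row) row
  bottomPartOK-self k P row dec noninc partsOK marksOK = All.tabulate ok
    where
    above : ∀ {a j} → (a , suc j) ∈ row → Mval k P row j < a
    above {j = zero} a∈ = proj₁ (All.lookup partsOK a∈)
    above {a} {suc i} a∈ rewrite ≢⇒≡ᵇ≡false (ℕ.<⇒≢ (ℕ.<-≤-trans (ℕ.n<1+n (suc i)) (proj₂ (All.lookup marksOK a∈)))) =
      largestWithMark-< row (proj₁ (All.lookup partsOK a∈))
        (All.tabulate λ y∈ y-mark → smaller-mark⇒smaller-part dec noninc a∈ y∈ (subst (_< suc (suc i)) (sym y-mark) (ℕ.n<1+n (suc i))))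
    ok : ∀ {x} → x ∈ row → T (bottomPartOK k P row x)
    ok {a , zero} x∈ = ⊥-elim (ℕ.<-irrefl refl (proj₁ (All.lookup marksOK x∈)))
    ok {a , suc j} x∈ with suc j ≡ᵇ k
    ... | true = T-∧⁺ (ℕ.<⇒<ᵇ (above x∈)) (ℕ.<⇒<ᵇ (proj₂ (All.lookup partsOK x∈)))
    ... | false = T-∧⁺ (ℕ.<⇒<ᵇ (above x∈)) (ℕ.≤⇒≤ᵇ (largestWithMark-≥ row x∈))

  marksDescend : (q : ℕ) (row : Row) → 1 ≤ q → MarksNonincreasing row → All (λ x → 1 ≤ proj₂ x × proj₂ x ≤ q) row →
    (∀ {i} → 1 ≤ i → i < q → i ∈ marks row) → MarksDescend q row
  marksDescend (suc zero) [] _ _ _ _ = refl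
  marksDescend (suc (suc q)) [] _ _ _ cover with () ← cover (s≤s z≤n) (s≤s (s≤s z≤n))
  marksDescend (suc q) ((a , j) ∷ row) _ (j≥ ∷ noninc) ((1≤j , j≤q) ∷ marksOK) cover =
    j~q , 1≤j , marksDescend j row 1≤j noninc (All.zipWith (λ ((1≤i , _) , i≤j) → 1≤i , i≤j) (marksOK , j≥)) cover′
    where
    cover′ : ∀ {i} → 1 ≤ i → i < j → i ∈ marks row
    cover′ 1≤i i<j with cover 1≤i (ℕ.<-≤-trans i<j j≤q)
    ... | here refl = ⊥-elim (ℕ.<-irrefl refl i<j)
    ... | there i∈ = i∈
    j~q : j ≡ suc q ⊎ suc j ≡ suc q
    j~q with ℕ.m≤n⇒m<n∨m≡n j≤q
    ... | inj₂ j≡q = inj₁ j≡q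
    ... | inj₁ (s≤s j≤q′) with ℕ.m≤n⇒m<n∨m≡n j≤q′
    ...   | inj₂ j≡q′ = inj₂ (cong suc j≡q′)
    ...   | inj₁ j<q′ with cover (ℕ.≤-trans 1≤j (ℕ.<⇒≤ j<q′)) (ℕ.n<1+n q)
    ...     | here q≡j = ⊥-elim (ℕ.<-irrefl (sym q≡j) j<q′)
    ...     | there q∈ = ⊥-elim (ℕ.<⇒≱ j<q′ (All.lookup (All.map⁺ j≥) q∈))

  -- Condition (3) is not a field: for a self-conjugate symbol it follows from the others
  -- (`bottomPartOK-self`).
  record SelfConjugate (k P : ℕ) (row : Row) : Set where
    field
      peak : 1 ≤ P
      partsBounded : All (λ x → 1 ≤ proj₁ x × proj₁ x < P) row
      marksBounded : All (λ x → 1 ≤ proj₂ x × proj₂ x ≤ k) row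
      partsDecreasing : PartsDecreasing row
      marksNonincreasing : MarksNonincreasing row
      cover : ∀ {j} → 1 ≤ j → j < k → j ∈ marks row

  T-isKMarkedSymbol : {k P : ℕ} {row : Row} → T (isKMarkedSymbol k P row row) ⇔ SelfConjugate k P row
  T-isKMarkedSymbol {k} {P} {row} = mk⇔ to from
    where
    partOK markOK : ℕ → Bool
    partOK a = (1 ≤ᵇ a) ∧ (a <ᵇ P)
    markOK m = (1 ≤ᵇ m) ∧ (m ≤ᵇ k)
    partsAll = all partOK (parts row)
    marksAll = all markOK (marks row)
    dec = strictlyDecreasing (parts row)
    noninc = nonincreasing (marks row)
    coverAll = all (λ j → elem j (marks row)) (map suc (upTo (k ∸ 1)))
    to : T (isKMarkedSymbol k P row row) → SelfConjugate k P row
    to t with peakT , t ← T-∧⁻ {1 ≤ᵇ P} t with partsT , t ← T-∧⁻ {partsAll} t with _ , t ← T-∧⁻ {partsAll} t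
         with marksT , t ← T-∧⁻ {marksAll} t with _ , t ← T-∧⁻ {marksAll} t with decT , t ← T-∧⁻ {dec} t
         with nonincT , t ← T-∧⁻ {noninc} t with _ , t ← T-∧⁻ {dec} t with _ , t ← T-∧⁻ {noninc} t
         with coverT , _ ← T-∧⁻ {coverAll} t = record
      { peak = ℕ.≤ᵇ⇒≤ 1 P peakT
      ; partsBounded = All.map (λ t → let p , q = T-∧⁻ t in ℕ.≤ᵇ⇒≤ 1 _ p , ℕ.<ᵇ⇒< _ P q)
                               (All.map⁻ (All.all⁺ partOK (parts row) partsT))
      ; marksBounded = All.map (λ t → let p , q = T-∧⁻ t in ℕ.≤ᵇ⇒≤ 1 _ p , ℕ.≤ᵇ⇒≤ _ k q)
                               (All.map⁻ (All.all⁺ markOK (marks row) marksT))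
      ; partsDecreasing = Linked⇒AllPairs (λ x>y y>z → ℕ.<-trans y>z x>y)
                                          (Linked.map⁻ (Equivalence.to T-strictlyDecreasing decT))
      ; marksNonincreasing = Linked⇒AllPairs ≥-trans (Linked.map⁻ (Equivalence.to T-nonincreasing nonincT))
      ; cover = λ {j} 1≤j j<k → covered j 1≤j j<k (All.all⁺ (λ j → elem j (marks row)) _ coverT)
      }
      where
      covered : ∀ j → 1 ≤ j → j < k → All (λ j → T (elem j (marks row))) (map suc (upTo (k ∸ 1))) → j ∈ marks row
      covered (suc i) _ i<k all = Equivalence.to T-elem (All.lookup all (∈-map⁺ suc (∈-upTo⁺ (ℕ.∸-monoˡ-≤ 1 i<k))))
    from : SelfConjugate k P row → T (isKMarkedSymbol k P row row)
    from s = T-∧⁺ (ℕ.≤⇒≤ᵇ peak) (T-∧⁺ partsT (T-∧⁺ partsT (T-∧⁺ marksT (T-∧⁺ marksT (T-∧⁺ decT (T-∧⁺ nonincT (T-∧⁺ decT (T-∧⁺ nonincT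
             (T-∧⁺ coverT (All.all⁻ _ (bottomPartOK-self k P row partsDecreasing marksNonincreasing partsBounded marksBounded)))))))))))
      where
      open SelfConjugate s
      partsT = All.all⁻ partOK (All.map⁺ (All.map (λ (p , q) → T-∧⁺ (ℕ.≤⇒≤ᵇ p) (ℕ.<⇒<ᵇ q)) partsBounded))
      marksT = All.all⁻ markOK (All.map⁺ (All.map (λ (p , q) → T-∧⁺ (ℕ.≤⇒≤ᵇ p) (ℕ.≤⇒≤ᵇ q)) marksBounded))
      decT = Equivalence.from T-strictlyDecreasing (Linked.map⁺ (AllPairs⇒Linked partsDecreasing))
      nonincT = Equivalence.from T-nonincreasing (Linked.map⁺ (AllPairs⇒Linked marksNonincreasing))
      coverT = All.all⁻ (λ j → elem j (marks row)) (All.tabulate λ j∈ → covered (∈-map⁻ suc j∈))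
        where
        covered : ∀ {j} → Σ ℕ (λ i → i ∈ upTo (k ∸ 1) × j ≡ suc i) → T (elem j (marks row))
        covered (i , i∈ , refl) = Equivalence.from T-elem (cover (s≤s z≤n) (<∸1⇒suc< (∈-upTo⁻ i∈)))

  cells-unique : Unique cells
  cells-unique = ((λ ()) ∷ (λ ()) ∷ []) ∷ ((λ ()) ∷ []) ∷ [] ∷ []

  ∈-cells : (c : Cell) → c ∈ cells
  ∈-cells absent = here refl
  ∈-cells present = there (here refl)
  ∈-cells present-max = there (there (here refl))

  decodeSymbol : List Cell → ℕ × Row
  decodeSymbol word = suc (length word) , rowOf (reverse word)

  encodeSymbol : ℕ → ℕ × Row → List Cell
  encodeSymbol k (P , row) = reverse (encodeRow k (P ∸ 1) 0 row)

  module _ (k n : ℕ) (1≤k : 1 ≤ k) where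

    scCondition : List Cell → Bool
    scCondition word = (SC.wordTags word ≡ᵇ k ∸ 1) ∧ (suc (SC.wordSize 1 word) ≡ᵇ n)

    decodeSymbol-valid : (word : List Cell) → SC.wordTags word ≡ k ∸ 1 → SelfConjugate k (suc (length word)) (rowOf (reverse word))
    decodeSymbol-valid word tags = record
      { peak = s≤s z≤n
      ; partsBounded = All.map (λ (p , q) → p , s≤s (subst (_ ≤_) (length-reverse word) q)) (rowOf-parts (reverse word))
      ; marksBounded = All.map (λ (p , q) → p , ℕ.≤-trans q (ℕ.≤-reflexive (trans (cong suc tagsRev) (ℕ.m+[n∸m]≡n 1≤k))))
                               (rowOf-marks (reverse word))
      ; partsDecreasing = rowOf-decreasing (reverse word)
      ; marksNonincreasing = rowOf-nonincreasing (reverse word)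
      ; cover = λ 1≤j j<k → rowOf-cover (reverse word) 1≤j (subst (_ ≤_) (sym tagsRev) (ℕ.∸-monoˡ-≤ 1 j<k))
      }
      where tagsRev = trans (sc-wordTags-reverse word) tags

    encode-decodeSymbol : (word : List Cell) → SC.wordTags word ≡ k ∸ 1 → encodeSymbol k (decodeSymbol word) ≡ word
    encode-decodeSymbol word tags = begin
      reverse (encodeRow k (length word) 0 (rowOf (reverse word)))
        ≡⟨ cong (λ l → reverse (encodeRow k l 0 (rowOf (reverse word)))) (length-reverse word) ⟨
      reverse (encodeRow k (length (reverse word)) 0 (rowOf (reverse word)))
        ≡⟨ cong reverse (encodeRow-rowOf k 1≤k (reverse word) 0 (inj₂ (refl , tagsRev) , ℕ.≤-reflexive tagsRev)) ⟩
      reverse (reverse word)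
        ≡⟨ reverse-involutive word ⟩
      word ∎
      where
      open ≡-Reasoning
      tagsRev = trans (sc-wordTags-reverse word) tags

    selfConjugate-partsIn : {P : ℕ} {row : Row} → SelfConjugate k P row → PartsIn (P ∸ 1) row
    selfConjugate-partsIn s = All.map (λ (p , q) → p , ℕ.∸-monoˡ-≤ 1 q) (SelfConjugate.partsBounded s)

    selfConjugate-descend : {P : ℕ} {row : Row} → SelfConjugate k P row → MarksDescend k row
    selfConjugate-descend {row = row} s = marksDescend k row 1≤k marksNonincreasing marksBounded cover
      where open SelfConjugate s

    decode-encodeSymbol : {P : ℕ} {row : Row} → SelfConjugate k P row → decodeSymbol (encodeSymbol k (P , row)) ≡ (P , row)
    decode-encodeSymbol {P} {row} s = cong₂ _,_ peakEq rowEq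
      where
      open SelfConjugate s
      e = encodeRow k (P ∸ 1) 0 row
      peakEq : suc (length (reverse e)) ≡ P
      peakEq = trans (cong suc (trans (length-reverse e) (length-encodeRow k (P ∸ 1) 0 row))) (ℕ.m+[n∸m]≡n peak)
      rowEq : rowOf (reverse (reverse e)) ≡ row
      rowEq = trans (cong rowOf (reverse-involutive e))
        (rowOf-encodeRow k (P ∸ 1) 0 k row partsDecreasing (selfConjugate-partsIn s) (selfConjugate-descend s) (All.map proj₂ marksBounded))

    encodeSymbol-condition : {P : ℕ} {row : Row} → SelfConjugate k P row → symbolSize P row row ≡ n →
      T (scCondition (encodeSymbol k (P , row)))
    encodeSymbol-condition {P} {row} s size = T-∧⁺ (ℕ.≡⇒≡ᵇ _ _ tags) (ℕ.≡⇒≡ᵇ _ _ size′)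
      where
      open SelfConjugate s
      word = encodeSymbol k (P , row)
      tags : SC.wordTags word ≡ k ∸ 1
      tags = trans (sc-wordTags-reverse (encodeRow k (P ∸ 1) 0 row))
                   (tags-encodeRow k (P ∸ 1) 0 k row 1≤k ℕ.≤-refl (inj₂ (refl , refl)) partsDecreasing
                                   (selfConjugate-partsIn s) (selfConjugate-descend s))
      size′ : suc (SC.wordSize 1 word) ≡ n
      size′ = trans (sym (symbolSize-decodeSymbol word)) (trans (cong (λ (P , row) → symbolSize P row row) (decode-encodeSymbol s)) size)

    selfConjugate-count : SCU k n ≡ count scCondition (listsUpTo n cells)
    selfConjugate-count = count-bijection (encodeSymbol k) decodeSymbol
      (Unique.cartesianProduct⁺ (range-unique n) (listsUpTo-unique n (Unique.cartesianProduct⁺ (range-unique n) (range-unique k))))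
      (listsUpTo-unique n cells-unique)
      forth back
      where
      forth : ∀ {x} → x ∈ scuCandidates k n → T (isSelfConjOfSize k n x) →
              encodeSymbol k x ∈ listsUpTo n cells × T (scCondition (encodeSymbol k x)) × decodeSymbol (encodeSymbol k x) ≡ x
      forth {P , row} _ valid = member , encodeSymbol-condition s size , decode-encodeSymbol s
        where
        s = Equivalence.to T-isKMarkedSymbol (proj₁ (T-∧⁻ valid))
        size = ℕ.≡ᵇ⇒≡ _ _ (proj₂ (T-∧⁻ valid))
        member = ∈-listsUpTo⁺ (subst (_≤ n) (sym (trans (length-reverse (encodeRow k (P ∸ 1) 0 row)) (length-encodeRow k (P ∸ 1) 0 row)))
                                 (ℕ.≤-trans (ℕ.m∸n≤m P 1) (ℕ.≤-trans (ℕ.m≤m+n P _) (ℕ.≤-trans (ℕ.m≤m+n _ _) (ℕ.≤-reflexive size)))))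
                               (All.universal ∈-cells _)
      back : ∀ {word} → word ∈ listsUpTo n cells → T (scCondition word) →
             decodeSymbol word ∈ scuCandidates k n × T (isSelfConjOfSize k n (decodeSymbol word)) ×
             encodeSymbol k (decodeSymbol word) ≡ word
      back {word} _ cond = member , T-∧⁺ (Equivalence.from T-isKMarkedSymbol s) (ℕ.≡⇒≡ᵇ _ _ size) , encode-decodeSymbol word tags
        where
        conds = T-∧⁻ {SC.wordTags word ≡ᵇ k ∸ 1} cond
        tags = ℕ.≡ᵇ⇒≡ _ _ (proj₁ conds)
        s = decodeSymbol-valid word tags
        size = trans (symbolSize-decodeSymbol word) (ℕ.≡ᵇ⇒≡ _ n (proj₂ conds))
        open SelfConjugate s
        row = rowOf (reverse word)
        P≤n : suc (length word) ≤ n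
        P≤n = ℕ.≤-trans (ℕ.m≤m+n _ _) (ℕ.≤-trans (ℕ.m≤m+n _ _) (ℕ.≤-reflexive size))
        rowLength≤n : length row ≤ n
        rowLength≤n = ℕ.≤-trans
          (subst (_≤ sum (parts row)) (length-map proj₁ row) (length≤sum (parts row) (All.map⁺ (All.map proj₁ partsBounded))))
          (ℕ.≤-trans (ℕ.m≤n+m (sum (parts row)) (suc (length word))) (ℕ.≤-trans (ℕ.m≤m+n _ (sum (parts row))) (ℕ.≤-reflexive size)))
        member = ∈-cartesianProduct⁺ (∈-range⁺ P≤n)
          (∈-listsUpTo⁺ rowLength≤n
            (All.zipWith (λ ((_ , a<P) , (_ , j≤k)) → ∈-cartesianProduct⁺ (∈-range⁺ (ℕ.≤-trans (ℕ.<⇒≤ a<P) P≤n)) (∈-range⁺ j≤k))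
                                                  (partsBounded , marksBounded)))

  -- The counts as coefficients

  SCU≡gf : (k n : ℕ) → 1 ≤ k → + SCU k (suc n) ≡ SC.gf cells (suc n) 1 (k ∸ 1) n
  SCU≡gf k n 1≤k = begin
    + SCU k (suc n)
      ≡⟨ cong +_ (selfConjugate-count k (suc n) 1≤k) ⟩
    + count (scCondition k (suc n) 1≤k) words
      ≡⟨ count-∑ _ words ⟩
    ∑[ word ← words ] when (scCondition k (suc n) 1≤k word) 1ℤ
      ≡⟨ ∑-cong words (λ word → cong (when (scCondition k (suc n) 1≤k word)) (sym (scWordSign word))) ⟩
    SC.gf cells (suc n) 1 (k ∸ 1) n ∎
    where
    open ≡-Reasoning
    words = listsUpTo (suc n) cells

  ω-ε≡-gf : (k n : ℕ) → 1 ≤ k → + ω k (suc n) - + ε k (suc n) ≡ - OE.gf (oeLetters (suc n)) (suc n) 1 (k ∸ 1) n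
  ω-ε≡-gf k n 1≤k = begin
    + ω k (suc n) - + ε k (suc n)
      ≡⟨ cong₂ (λ a b → + a - + b) (omegaEps-count true k (suc n) 1≤k) (omegaEps-count false k (suc n) 1≤k) ⟩
    + count (oeCondition true k (suc n)) words - + count (oeCondition false k (suc n)) words
      ≡⟨ signed-count condition evenCount words ⟩
    - (∑[ word ← words ] when (condition word) (-1ℤ ^ evenCount word))
      ≡⟨ cong -_ (∑-cong words (λ word → cong (when (condition word)) (sym (oeWordSign word)))) ⟩
    - OE.gf (oeLetters (suc n)) (suc n) 1 (k ∸ 1) n ∎
    where
    open ≡-Reasoning
    words = listsUpTo (suc n) (oeLetters (suc n))
    condition : List OELetter → Bool
    condition word = (OE.wordTags word ≡ᵇ k ∸ 1) ∧ (suc (OE.wordSize 1 word) ≡ᵇ suc n)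

  SCU-0 : (k : ℕ) → 1 ≤ k → SCU k 0 ≡ 0
  SCU-0 k 1≤k = trans (selfConjugate-count k 0 1≤k)
    (count-none (scCondition k 0 1≤k) (All.universal (λ word → proj₂ ∘ T-∧⁻ {SC.wordTags word ≡ᵇ k ∸ 1}) (listsUpTo 0 cells)))

  omegaEps-0 : (par : Bool) (k : ℕ) → 1 ≤ k → count (isOmegaEps par k 0) (oeCandidates 0) ≡ 0
  omegaEps-0 par k 1≤k = trans (omegaEps-count par k 0 1≤k)
    (count-none (oeCondition par k 0)
      (All.universal (λ word → proj₂ ∘ T-∧⁻ {OE.wordTags word ≡ᵇ k ∸ 1} ∘ proj₁ ∘ T-∧⁻) (listsUpTo 0 (oeLetters 0))))

  sign-cancel : (m : ℕ) (g : ℤ) → -1ℤ ^ suc m *ℤ - (-1ℤ ^ m *ℤ g) ≡ g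
  sign-cancel m g = trans (regroup (-1ℤ ^ m) g) (trans (cong (_*ℤ g) (sign-square m)) (ℤ.*-identityˡ g))
    where
    regroup : ∀ s g → -1ℤ *ℤ s *ℤ - (s *ℤ g) ≡ s *ℤ s *ℤ g
    regroup = solve-∀

open import Data.Integer using (_*_)

theorem1p6 : (k : ℕ) → 2 ≤ k → (n : ℕ) →
    + SCU k n ≡ (- + 1) ^ k * (+ ω k n - + ε k n)
theorem1p6 k@(suc _) _ zero rewrite SCU-0 k (s≤s z≤n) | omegaEps-0 true k (s≤s z≤n) | omegaEps-0 false k (s≤s z≤n) =
  sym (ℤ.*-zeroʳ (-1ℤ ^ k))
theorem1p6 k@(suc k′) _ (suc n) = begin
  + SCU k (suc n)
    ≡⟨ SCU≡gf k n (s≤s z≤n) ⟩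
  SC.gf cells (suc n) 1 k′ n
    ≡⟨ sign-cancel k′ _ ⟨
  -1ℤ ^ k * - (-1ℤ ^ k′ * SC.gf cells (suc n) 1 k′ n)
    ≡⟨ cong (λ g → -1ℤ ^ k * - g) (oe-gf≡±sc-gf (suc n) (suc n) 1 k′ n (s≤s z≤n) (ℕ.n≤1+n n)) ⟨
  -1ℤ ^ k * - OE.gf (oeLetters (suc n)) (suc n) 1 k′ n
    ≡⟨ cong (-1ℤ ^ k *_) (ω-ε≡-gf k n (s≤s z≤n)) ⟨
  -1ℤ ^ k * (+ ω k (suc n) - + ε k (suc n)) ∎
  where open ≡-Reasoning
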